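{- Let $0\le k\le n$. For every $f\in\operatorname{Bound}(k,n)$, the bounded affine Lascoux–Schützenberger tree of $f$ is finite.
   Context: Affine permutations $\widetilde S_n$: bijections $f:\mathbb{Z}\to\mathbb{Z}$ with $f(i+n)=f(i)+n$. $\ell(f)=\#\{(i,j):1\le i\le n,\ i<j,\ f(i)>f(j)\}$. For $i<j$, $i\not\equiv j\pmod n$, $t_{ij}$ swaps $i+pn$ and $j+pn$ for all $p\in\mathbb{Z}$. Bruhat cover: $f\lessdot ft_{ij}$ iff $\ell(ft_{ij})=\ell(f)+1$. $\operatorname{Bound}(k,n)$ is the set of $f$ with $i\le f(i)\le i+n$ for all $i$ and exactly $k$ of $f(1),\dots,f(n)$ exceeding $n$. For $r\in\mathbb{Z}$: $\Phi^+(f,r)=\{ft_{rj}: r<j,\ f\lessdot ft_{rj}\}$, $\Phi^-(f,r)=\{ft_{ir}: i<r,\ f\lessdot ft_{ir}\}$, $B\Phi^\pm(f,r)=\Phi^\pm(f,r)\cap\operatorname{Bound}(k,n)$. The maximal inversion of $g\in\operatorname{Bound}(k,n)$ is the lexicographically largest $(r,s)$ with $1\le r<s\le n$, $g(r)>g(s)$; if there is none, $g$ is $0$-Grassmannian. The bounded affine L-S tree of $f$ is the rooted tree with vertices labeled by elements of $\operatorname{Bound}(k,n)$: the root is $f$; a $0$-Grassmannian vertex $g$ has no children; otherwise, with $(r,s)$ the maximal inversion of $g$, the children of $g$ are the elements of $B\Phi^-(gt_{rs},r)$ and of $B\Phi^+(gt_{rs},r)\setminus\{g\}$. -}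

module Defs where

open import Data.Nat as ℕ using (ℕ; NonZero)
open import Data.Integer using (ℤ; +_; _+_; _-_; _<_; _≤_; _<?_; _%ℕ_)
open import Data.Fin using (Fin; toℕ)
open import Data.Vec using (Vec; tabulate)
open import Data.List using (List; []; _∷_; length; filter; map; allFin)
open import Data.List.Membership.Propositional using (_∈_)
open import Data.List.Relation.Unary.Unique.Propositional using (Unique)
open import Data.Product using (Σ; ∃; _×_; _,_)
open import Data.Sum using (_⊎_)
open import Data.Bool using (if_then_else_)
open import Relation.Nullary using (¬_; ⌊_⌋)
open import Relation.Binary.PropositionalEquality using (_≡_)
open import Function.Definitions using (Bijective)

_≡[_]_ : ℤ → (n : ℕ) → .{{NonZero n}} → ℤ → Set
x ≡[ n ] y = ((x - y) %ℕ n) ≡ 0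

IsAffPerm : (n : ℕ) → (ℤ → ℤ) → Set
IsAffPerm n f = (∀ i → f (i + + n) ≡ f i + + n) × Bijective _≡_ _≡_ f

Inv : (n : ℕ) → (ℤ → ℤ) → ℤ × ℤ → Set
Inv n f (i , j) = (+ 1 ≤ i) × (i ≤ + n) × (i < j) × (f j < f i)

HasLength : (n : ℕ) → (ℤ → ℤ) → ℕ → Set
HasLength n f m = Σ (List (ℤ × ℤ)) λ L →
  Unique L × (∀ p → p ∈ L → Inv n f p) × (∀ p → Inv n f p → p ∈ L) × length L ≡ m

Covers : (n : ℕ) → (ℤ → ℤ) → (ℤ → ℤ) → Set
Covers n f g = ∃ λ m → HasLength n f m × HasLength n g (ℕ.suc m)

-- the affine transposition t_{ij}: swaps i + pn and j + pn for all p
t : (n : ℕ) → .{{NonZero n}} → ℤ → ℤ → ℤ → ℤ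
t n i j x =
  if ⌊ ((x - i) %ℕ n) ℕ.≟ 0 ⌋ then x - i + j
  else (if ⌊ ((x - j) %ℕ n) ℕ.≟ 0 ⌋ then x - j + i else x)

_≗_ : (ℤ → ℤ) → (ℤ → ℤ) → Set
f ≗ g = ∀ x → f x ≡ g x

InBound : (k n : ℕ) → (ℤ → ℤ) → Set
InBound k n f = IsAffPerm n f
  × (∀ i → (i ≤ f i) × (f i ≤ i + + n))
  × length (filter (λ (i : Fin n) → + n <? f (+ ℕ.suc (toℕ i))) (allFin n)) ≡ k

Φ⁺ : (n : ℕ) → .{{NonZero n}} → (ℤ → ℤ) → ℤ → (ℤ → ℤ) → Set
Φ⁺ n f r h = ∃ λ j → (r < j) × ¬ (r ≡[ n ] j)
  × (h ≗ (λ x → f (t n r j x))) × Covers n f h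

Φ⁻ : (n : ℕ) → .{{NonZero n}} → (ℤ → ℤ) → ℤ → (ℤ → ℤ) → Set
Φ⁻ n f r h = ∃ λ i → (i < r) × ¬ (i ≡[ n ] r)
  × (h ≗ (λ x → f (t n i r x))) × Covers n f h

BΦ⁺ : (k n : ℕ) → .{{NonZero n}} → (ℤ → ℤ) → ℤ → (ℤ → ℤ) → Set
BΦ⁺ k n f r h = Φ⁺ n f r h × InBound k n h

BΦ⁻ : (k n : ℕ) → .{{NonZero n}} → (ℤ → ℤ) → ℤ → (ℤ → ℤ) → Set
BΦ⁻ k n f r h = Φ⁻ n f r h × InBound k n h

WInv : (n : ℕ) → (ℤ → ℤ) → ℤ → ℤ → Set
WInv n g r s = (+ 1 ≤ r) × (r < s) × (s ≤ + n) × (g s < g r)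

_≤lex_ : ℤ × ℤ → ℤ × ℤ → Set
(a , b) ≤lex (c , d) = (a < c) ⊎ ((a ≡ c) × (b ≤ d))

MaxInv : (n : ℕ) → (ℤ → ℤ) → ℤ → ℤ → Set
MaxInv n g r s = WInv n g r s × (∀ r' s' → WInv n g r' s' → (r' , s') ≤lex (r , s))

-- h is (the label of) a child of the vertex labelled g in the bounded affine L-S tree.
-- (A 0-Grassmannian g has no maximal inversion, hence no children.)
Child : (k n : ℕ) → .{{NonZero n}} → (ℤ → ℤ) → (ℤ → ℤ) → Set
Child k n g h = ∃ λ r → ∃ λ s → MaxInv n g r s ×
  (BΦ⁻ k n (λ x → g (t n r s x)) r h
   ⊎ (BΦ⁺ k n (λ x → g (t n r s x)) r h × ¬ (h ≗ g)))

-- Path g ps : ps = (g₁ , … , gₘ) is the sequence of labels along a downward path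
-- starting at the vertex labelled g (g₁ a child of g, g₂ a child of g₁, …).
-- Vertices of the tree rooted at f correspond exactly to such paths from f.
data Path (k n : ℕ) .{{_ : NonZero n}} : (ℤ → ℤ) → List (ℤ → ℤ) → Set where
  stop : ∀ {g} → Path k n g []
  step : ∀ {g h ps} → Child k n g h → Path k n h ps → Path k n g (h ∷ ps)

-- window [f(1), …, f(n)] (determines an affine permutation)
window : (n : ℕ) → (ℤ → ℤ) → Vec ℤ n
window n f = tabulate (λ i → f (+ ℕ.suc (toℕ i)))

-- the tree rooted at f is finite: its vertices (paths from the root, recorded
-- by the windows of their labels) all lie in one finite list
TreeFinite : (k n : ℕ) → .{{NonZero n}} → (ℤ → ℤ) → Set
TreeFinite k n f = ∃ λ (L : List (List (Vec ℤ n))) →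
  ∀ ps → Path k n f ps → map (window n) ps ∈ L

module Submission where

-- Read the window displacements g p - p ∈ {0..n} of a bounded g as base-(n+1)
-- digits, most significant at the right end of the window ('weight').  Every
-- child h of g is larger in reverse-lexicographic order of windows
-- ('RevLexAbove', 'child-above'), so the weight strictly increases along a
-- path and, being below (n+1)^n, bounds its length; all windows lie in
-- {1..2n}^n, so finitely many lists of windows cover every path.
-- For 'child-above', write h = v t with v = g t_{rs}, (r , s) the maximal
-- inversion: where the two entries moved by t sit relative to r and s either
-- gives the position q where h exceeds g, or yields a swap that changes ℓ(v)
-- by the wrong amount for v ⋖ h.  Those cases are excluded by exchange
-- arguments on window inversions ('intermediate-value-swap',
-- 'shifted-ascent-swap'), once ℓ is read as a count of window inversions
-- ('window-length').

open import Defs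
open import Data.Nat as ℕ using (ℕ; NonZero; zero; suc)
open import Data.Nat using (_≤_)
import Data.Nat.Properties as ℕP
import Data.Nat.DivMod as ℕD
open import Data.Integer as ℤ using (ℤ; +_; -[1+_]; _+_; _-_; -_; _*_; _<_; _%ℕ_; _/ℕ_; +≤+; +<+; 1ℤ; 0ℤ)
  renaming (_≤_ to _≤ᶻ_)
import Data.Integer.Properties as ℤP
open import Data.Integer.DivMod using (a≡a%ℕn+[a/ℕn]*n; n%ℕd<d)
open import Data.Integer.Tactic.RingSolver using (solve-∀)
open import Data.List using (List; []; _∷_; map; length; _++_; concatMap)
import Data.List.Properties as LP
open import Data.Vec as V using (Vec)
open import Data.Fin as Fin using (Fin; toℕ)
import Data.Fin.Properties as FP
open import Data.List.Relation.Unary.Unique.Propositional using (Unique)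
import Data.List.Relation.Unary.Unique.Propositional.Properties as Uniqueₚ
open import Data.List.Relation.Unary.AllPairs using ([]; _∷_)
open import Data.List.Relation.Unary.All as All using (All; []; _∷_)
import Data.List.Relation.Unary.All.Properties as Allₚ
open import Data.List.Membership.Propositional using (_∈_)
import Data.List.Membership.Propositional.Properties as ∈ₚ
open import Data.List.Relation.Unary.Any using (here; there)
open import Data.Product using (Σ; _×_; _,_; proj₁; proj₂)
open import Data.Sum using (_⊎_; inj₁; inj₂)
open import Data.Bool using (if_then_else_)
open import Function using (_∘_)
open import Data.Empty using (⊥; ⊥-elim)
open import Relation.Nullary using (¬_; ⌊_⌋; yes; no; Dec)
open import Relation.Binary.Definitions using (tri<; tri≈; tri>)
open import Relation.Nullary.Decidable using (_×-dec_; _⊎-dec_)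
open import Relation.Binary.PropositionalEquality
  using (_≡_; refl; sym; cong; cong₂; subst; subst₂; _≢_)
  renaming (trans to infixr 4 _∙_)

-- Counting with duplicate-free lists

module Counting {A : Set} where
  remove : ∀ {x : A} (ys : List A) → x ∈ ys → List A
  remove (y ∷ ys) (here _) = ys
  remove (y ∷ ys) (there p) = y ∷ remove ys p

  length-remove : ∀ {x : A} (ys : List A) (p : x ∈ ys) → suc (length (remove ys p)) ≡ length ys
  length-remove (y ∷ ys) (here _) = refl
  length-remove (y ∷ ys) (there p) = cong suc (length-remove ys p)

  ∈-remove : ∀ {x z : A} (ys : List A) (p : x ∈ ys) → z ∈ ys → z ≢ x → z ∈ remove ys p
  ∈-remove (y ∷ ys) (here refl) (here refl) z≢x = ⊥-elim (z≢x refl)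
  ∈-remove (y ∷ ys) (here refl) (there q) z≢x = q
  ∈-remove (y ∷ ys) (there p) (here refl) z≢x = here refl
  ∈-remove (y ∷ ys) (there p) (there q) z≢x = there (∈-remove ys p q z≢x)

  unique-⊆-length : ∀ {xs ys : List A} → Unique xs → (∀ z → z ∈ xs → z ∈ ys) →
    length xs ℕ.≤ length ys
  unique-⊆-length {[]} _ _ = ℕ.z≤n
  unique-⊆-length {x ∷ xs} {ys} (x∉xs ∷ u) xs⊆ys =
    subst (suc (length xs) ℕ.≤_) (length-remove ys x∈ys) (ℕ.s≤s (unique-⊆-length u xs⊆ys-x))
    where
    x∈ys = xs⊆ys x (here refl)
    xs⊆ys-x : ∀ z → z ∈ xs → z ∈ remove ys x∈ys
    xs⊆ys-x z z∈ = ∈-remove ys x∈ys (xs⊆ys z (there z∈)) (λ e → All.lookup x∉xs z∈ (sym e))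

  map-unique : ∀ {xs : List A} (φ : A → A) → Unique xs →
    (∀ a b → a ∈ xs → b ∈ xs → φ a ≡ φ b → a ≡ b) → Unique (map φ xs)
  map-unique {[]} φ _ _ = []
  map-unique {x ∷ xs} φ (x∉xs ∷ u) inj =
    Allₚ.map⁺ (All.tabulate λ {z} z∈ e → All.lookup x∉xs z∈ (inj x z (here refl) (there z∈) e))
    ∷ map-unique φ u (λ a b a∈ b∈ → inj a b (there a∈) (there b∈))

  injection-count : ∀ {P Q : A → Set} {LA LB : List A} (φ : A → A) (es : List A) →
    Unique LA → (∀ a → a ∈ LA → P a) → (∀ b → Q b → b ∈ LB) →
    (∀ a → P a → Q (φ a)) → (∀ a b → P a → P b → φ a ≡ φ b → a ≡ b) →
    Unique es → All Q es → (∀ a → P a → All (φ a ≢_) es) →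
    length es ℕ.+ length LA ℕ.≤ length LB
  injection-count {P} {Q} {LA} {LB} φ es uA PA QB φPQ inj ues Qes outside =
    subst (ℕ._≤ length LB) len (unique-⊆-length uC C⊆LB)
    where
    C = es ++ map φ LA
    disjoint : ∀ {z} → z ∈ es → z ∈ map φ LA → ⊥
    disjoint z∈es z∈im with ∈ₚ.∈-map⁻ φ z∈im
    ... | a , a∈ , refl = All.lookup (outside a (PA a a∈)) z∈es refl
    uC : Unique C
    uC = Uniqueₚ.++⁺ ues (map-unique φ uA (λ a b a∈ b∈ → inj a b (PA a a∈) (PA b b∈)))
           (λ (z∈es , z∈im) → disjoint z∈es z∈im)
    C⊆LB : ∀ z → z ∈ C → z ∈ LB
    C⊆LB z z∈ with ∈ₚ.∈-++⁻ es z∈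
    ... | inj₁ z∈es = QB z (All.lookup Qes z∈es)
    ... | inj₂ z∈im with ∈ₚ.∈-map⁻ φ z∈im
    ...   | a , a∈ , refl = QB _ (φPQ a (PA a a∈))
    len : length C ≡ length es ℕ.+ length LA
    len = LP.length-++ es ∙ cong (length es ℕ.+_) (LP.length-map φ LA)

-- Finite enumerations

vectorsOver : ∀ {A : Set} → List A → (k : ℕ) → List (Vec A k)
vectorsOver R zero = V.[] ∷ []
vectorsOver R (suc k) = concatMap (λ a → map (a V.∷_) (vectorsOver R k)) R

∈-combine : ∀ {A B C : Set} {a : A} {R : List A} {b : B} (c : A → B → C) (L : List B) →
  a ∈ R → b ∈ L → c a b ∈ concatMap (λ a' → map (c a') L) R
∈-combine c L a∈R b∈L = ∈ₚ.∈-concat⁺′ (∈ₚ.∈-map⁺ _ b∈L) (∈ₚ.∈-map⁺ _ a∈R)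

vectorsOver-complete : ∀ {A : Set} {R : List A} k (v : Fin k → A) → (∀ i → v i ∈ R) →
  V.tabulate v ∈ vectorsOver R k
vectorsOver-complete zero v _ = here refl
vectorsOver-complete (suc k) v v∈R =
  ∈-combine V._∷_ _ (v∈R Fin.zero) (vectorsOver-complete k (v ∘ Fin.suc) (v∈R ∘ Fin.suc))

listsOver : ∀ {A : Set} → List A → ℕ → List (List A)
listsOver R zero = [] ∷ []
listsOver R (suc m) = [] ∷ concatMap (λ a → map (a ∷_) (listsOver R m)) R

listsOver-complete : ∀ {A : Set} {R : List A} m (xs : List A) → All (_∈ R) xs →
  length xs ℕ.≤ m → xs ∈ listsOver R m
listsOver-complete zero [] _ _ = here refl
listsOver-complete (suc m) [] _ _ = here refl
listsOver-complete (suc m) (x ∷ xs) (x∈R ∷ xs∈R) (ℕ.s≤s len≤) =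
  there (∈-combine _∷_ _ x∈R (listsOver-complete m xs xs∈R len≤))

infixl 5 _<≤_ _≤<_ _≤≤_ _<<_
_<≤_ : ∀ {a b c} → a < b → b ≤ᶻ c → a < c
_<≤_ = ℤP.<-≤-trans
_≤<_ : ∀ {a b c} → a ≤ᶻ b → b < c → a < c
_≤<_ = ℤP.≤-<-trans
_≤≤_ : ∀ {a b c} → a ≤ᶻ b → b ≤ᶻ c → a ≤ᶻ c
_≤≤_ = ℤP.≤-trans
_<<_ : ∀ {a b c} → a < b → b < c → a < c
_<<_ = ℤP.<-trans

irrefl : ∀ {a} → a < a → ⊥
irrefl = ℤP.<-irrefl refl

>⇒≢ : ∀ {a b} → a < b → b ≢ a
>⇒≢ a<b e = ℤP.<⇒≢ a<b (sym e)

+-cancel : ∀ x c → x + c - c ≡ x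
+-cancel = solve-∀

cancelʳ-≤ : ∀ {a b} c → a + c ≤ᶻ b + c → a ≤ᶻ b
cancelʳ-≤ {a} {b} c h = subst₂ _≤ᶻ_ (+-cancel a c) (+-cancel b c) (ℤP.+-monoˡ-≤ (- c) h)

cancelʳ-< : ∀ {a b} c → a + c < b + c → a < b
cancelʳ-< {a} {b} c h = subst₂ _<_ (+-cancel a c) (+-cancel b c) (ℤP.+-monoˡ-< (- c) h)

<-+pos : ∀ {a c} → + 1 ≤ᶻ c → a < a + c
<-+pos {a} {c} 1≤c = ℤP.suc[i]≤j⇒i<j (subst (_≤ᶻ a + c) (ℤP.+-comm a (+ 1)) (ℤP.+-monoʳ-≤ a 1≤c))

<-pos+ : ∀ {a c} → + 1 ≤ᶻ c → a < c + a
<-pos+ {a} {c} 1≤c = subst (a <_) (ℤP.+-comm a c) (<-+pos 1≤c)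

-- Multiples of the period, windows, transpositions and periodicity

module Period (n : ℕ) .{{_ : NonZero n}} where
  N : ℤ
  N = + n

  1≤N : + 1 ≤ᶻ N
  1≤N = +≤+ (ℕ.>-nonZero⁻¹ n)

  Mult : ℤ → Set
  Mult x = Σ ℤ λ k → x ≡ k * N

  mod≡0⇒Mult : ∀ x → x %ℕ n ≡ 0 → Mult x
  mod≡0⇒Mult x eq = (x /ℕ n) , (a≡a%ℕn+[a/ℕn]*n x n ∙ (cong (λ r → + r + (x /ℕ n) * N) eq ∙ ℤP.+-identityˡ _))

  Mult⇒mod≡0 : ∀ x → Mult x → x %ℕ n ≡ 0
  Mult⇒mod≡0 x (+ m , refl) rewrite sym (ℤP.pos-* m n) = ℕD.m*n%n≡0 m n
  Mult⇒mod≡0 x (-[1+ m ] , refl)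
    rewrite sym (ℤP.neg-distribˡ-* (+ suc m) N) | sym (ℤP.pos-* (suc m) n) =
    neg-mod (suc m ℕ.* n) (ℕD.m*n%n≡0 (suc m) n)
    where
    neg-mod : ∀ p → p ℕ.% n ≡ 0 → (- (+ p)) %ℕ n ≡ 0
    neg-mod zero eq = eq
    neg-mod (suc p) eq rewrite eq = refl

  Mult? : ∀ x → Dec (Mult x)
  Mult? x with (x %ℕ n) ℕ.≟ 0
  ... | yes e = yes (mod≡0⇒Mult x e)
  ... | no ne = no (λ d → ne (Mult⇒mod≡0 x d))

  ¬≡[n]⇒¬Mult : ∀ x y → ¬ (x ≡[ n ] y) → ¬ Mult (x - y)
  ¬≡[n]⇒¬Mult x y ne d = ne (Mult⇒mod≡0 _ d)

  Mult-+ : ∀ {a b} → Mult a → Mult b → Mult (a + b)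
  Mult-+ (k , refl) (l , refl) = (k + l) , sym (ℤP.*-distribʳ-+ N k l)

  Mult-neg : ∀ {a} → Mult a → Mult (- a)
  Mult-neg (k , refl) = (- k) , ℤP.neg-distribˡ-* k N

  Mult-sub : ∀ {a b} → Mult a → Mult b → Mult (a - b)
  Mult-sub da db = Mult-+ da (Mult-neg db)

  Mult-N : Mult N
  Mult-N = 1ℤ , sym (ℤP.*-identityˡ N)

  Mult-resp : ∀ {a b} → a ≡ b → Mult a → Mult b
  Mult-resp refl d = d

  Mult-x-x : ∀ x → Mult (x - x)
  Mult-x-x x = 0ℤ , ℤP.+-inverseʳ x

  Mult-flip : ∀ {x y} → Mult (x - y) → Mult (y - x)
  Mult-flip {x} {y} d = Mult-resp (neg-diff x y) (Mult-neg d)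
    where
    neg-diff : ∀ x y → - (x - y) ≡ y - x
    neg-diff = solve-∀

  Mult-trans : ∀ {x y z} → Mult (x - y) → Mult (y - z) → Mult (x - z)
  Mult-trans {x} {y} {z} d d' = Mult-resp (ℤP.+-minus-telescope x y z) (Mult-+ d d')

  N≤pos*N : ∀ m → N ≤ᶻ + suc m * N
  N≤pos*N m rewrite sym (ℤP.pos-* (suc m) n) = +≤+ (ℕP.m≤m+n n (m ℕ.* n))

  neg*N≤-N : ∀ m → -[1+ m ] * N ≤ᶻ - N
  neg*N≤-N m rewrite sym (ℤP.neg-distribˡ-* (+ suc m) N) = ℤP.neg-mono-≤ (N≤pos*N m)

  Mult-small⇒0 : ∀ {K} → Mult K → - N < K → K < N → K ≡ 0ℤ
  Mult-small⇒0 (+ zero , refl) _ _ = refl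
  Mult-small⇒0 (+ suc m , refl) _ K<N = ⊥-elim (irrefl (K<N <≤ N≤pos*N m))
  Mult-small⇒0 (-[1+ m ] , refl) -N<K _ = ⊥-elim (irrefl (-N<K <≤ neg*N≤-N m))

  Mult-negsmall⇒-N : ∀ {K} → Mult K → - N - N < K → K < 0ℤ → K ≡ - N
  Mult-negsmall⇒-N {K} d lo hi = unshift (Mult-small⇒0 (Mult-+ d Mult-N) lo' hi')
    where
    shift : ∀ N → - N - N + N ≡ - N
    shift = solve-∀
    lo' : - N < K + N
    lo' = subst (_< K + N) (shift N) (ℤP.+-monoˡ-< N lo)
    hi' : K + N < N
    hi' = subst (K + N <_) (ℤP.+-identityˡ N) (ℤP.+-monoˡ-< N hi)
    unshift : K + N ≡ 0ℤ → K ≡ - N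
    unshift e = sym (+-cancel K N) ∙ (cong (_- N) e ∙ ℤP.+-identityˡ (- N))

  InWindow : ℤ → Set
  InWindow p = (+ 1 ≤ᶻ p) × (p ≤ᶻ N)

  InWindow? : ∀ p → Dec (InWindow p)
  InWindow? p = (+ 1 ℤP.≤? p) ×-dec (p ℤP.≤? N)

  window-incongruent : ∀ {p q} → InWindow p → InWindow q → Mult (p - q) → p ≡ q
  window-incongruent {p} {q} (1≤p , p≤N) (1≤q , q≤N) d =
    ℤP.i-j≡0⇒i≡j p q (Mult-small⇒0 d lo hi)
    where
    hi-shift : ∀ p q → p + + 1 ≡ (+ 1 + (p - q)) + q
    hi-shift = solve-∀
    lo-shiftˡ : ∀ q N → q + + 1 ≡ (+ 1 + - N) + (q + N)
    lo-shiftˡ = solve-∀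
    lo-shiftʳ : ∀ p q N → N + p ≡ (p - q) + (q + N)
    lo-shiftʳ = solve-∀
    hi : p - q < N
    hi = ℤP.suc[i]≤j⇒i<j (cancelʳ-≤ q (subst (_≤ᶻ N + q) (hi-shift p q) (ℤP.+-mono-≤ p≤N 1≤q)))
    lo : - N < p - q
    lo = ℤP.suc[i]≤j⇒i<j (cancelʳ-≤ (q + N) (subst₂ _≤ᶻ_ (lo-shiftˡ q N) (lo-shiftʳ p q N) (ℤP.+-mono-≤ q≤N 1≤p)))

  window-representative : ∀ x → Σ ℤ λ x' → InWindow x' × Mult (x - x')
  window-representative x = + suc r , (+≤+ (ℕ.s≤s ℕ.z≤n) , +≤+ (n%ℕd<d (x - 1ℤ) n)) , (q , x-1-r≡qN)
    where
    r = (x - 1ℤ) %ℕ n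
    q = (x - 1ℤ) /ℕ n
    regroup : ∀ x r → x - (1ℤ + r) ≡ x - 1ℤ - r
    regroup = solve-∀
    cancel : ∀ r q → r + q - r ≡ q
    cancel = solve-∀
    x-1-r≡qN : x - + suc r ≡ q * N
    x-1-r≡qN = regroup x (+ r) ∙ (cong (_- + r) (a≡a%ℕn+[a/ℕn]*n (x - 1ℤ) n) ∙ cancel (+ r) (q * N))

  private
    if-zero : ∀ m {A : Set} (a b : A) → m ≡ 0 → (if ⌊ m ℕ.≟ 0 ⌋ then a else b) ≡ a
    if-zero zero a b _ = refl

    if-nonzero : ∀ m {A : Set} (a b : A) → m ≢ 0 → (if ⌊ m ℕ.≟ 0 ⌋ then a else b) ≡ b
    if-nonzero zero a b m≢0 = ⊥-elim (m≢0 refl)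
    if-nonzero (suc m) a b _ = refl

  t-at-i : ∀ i j x → Mult (x - i) → t n i j x ≡ x - i + j
  t-at-i i j x d = if-zero ((x - i) %ℕ n) _ _ (Mult⇒mod≡0 _ d)

  t-at-j : ∀ i j x → ¬ Mult (x - i) → Mult (x - j) → t n i j x ≡ x - j + i
  t-at-j i j x nd d =
    if-nonzero ((x - i) %ℕ n) _ _ (nd ∘ mod≡0⇒Mult _) ∙ if-zero ((x - j) %ℕ n) _ _ (Mult⇒mod≡0 _ d)

  t-elsewhere : ∀ i j x → ¬ Mult (x - i) → ¬ Mult (x - j) → t n i j x ≡ x
  t-elsewhere i j x nd nd' =
    if-nonzero ((x - i) %ℕ n) _ _ (nd ∘ mod≡0⇒Mult _) ∙ if-nonzero ((x - j) %ℕ n) _ _ (nd' ∘ mod≡0⇒Mult _)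

  module TranspositionOnWindow (a b a' b' : ℤ) (a'∈W : InWindow a') (b'∈W : InWindow b')
           (da : Mult (a - a')) (db : Mult (b - b')) (a'≢b' : a' ≢ b') where
    private
      rebase : ∀ p a a' → p - a + (a - a') ≡ p - a'
      rebase = solve-∀

      ¬Mult-other : ∀ {p c c'} → InWindow p → InWindow c' → Mult (c - c') → p ≢ c' → ¬ Mult (p - c)
      ¬Mult-other {p} {c} {c'} p∈W c'∈W dc p≢c' d =
        p≢c' (window-incongruent p∈W c'∈W (Mult-resp (rebase p c c') (Mult-+ d dc)))

    t-a' : t n a b a' ≡ a' - a + b
    t-a' = t-at-i a b a' (Mult-flip {a} da)

    t-b' : t n a b b' ≡ b' - b + a
    t-b' = t-at-j a b b' (¬Mult-other b'∈W a'∈W da (λ e → a'≢b' (sym e))) (Mult-flip {b} db)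

    t-other : ∀ p → InWindow p → p ≢ a' → p ≢ b' → t n a b p ≡ p
    t-other p p∈W p≢a' p≢b' =
      t-elsewhere a b p (¬Mult-other p∈W a'∈W da p≢a') (¬Mult-other p∈W b'∈W db p≢b')

  Periodic : (ℤ → ℤ) → Set
  Periodic f = ∀ x → f (x + N) ≡ f x + N

  periodic-+ : ∀ {f} → Periodic f → ∀ m x → f (x + + m * N) ≡ f x + + m * N
  periodic-+ {f} per zero x = cong f (ℤP.+-identityʳ x) ∙ sym (ℤP.+-identityʳ (f x))
  periodic-+ {f} per (suc m) x rewrite ℤP.suc-* (+ m) N =
    cong f (regroup x N (+ m * N)) ∙ (per _ ∙ (cong (_+ N) (periodic-+ {f} per m x) ∙ sym (regroup (f x) N (+ m * N))))
    where
    regroup : ∀ x N M → x + (N + M) ≡ (x + M) + N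
    regroup = solve-∀

  periodic-Mult : ∀ {f} → Periodic f → ∀ {K} → Mult K → ∀ x → f (x + K) ≡ f x + K
  periodic-Mult {f} per (+ m , refl) x = periodic-+ {f} per m x
  periodic-Mult {f} per (-[1+ m ] , refl) x rewrite sym (ℤP.neg-distribˡ-* (+ suc m) N) =
    sym (+-cancel (f (x - M)) M) ∙ cong (_- M) (sym (periodic-+ {f} per (suc m) (x - M)) ∙ cong f (minus-plus x M))
    where
    M = + suc m * N
    minus-plus : ∀ x M → x - M + M ≡ x
    minus-plus = solve-∀

  private
    shift-out : ∀ x N i j → x + N - i + j ≡ x - i + j + N
    shift-out = solve-∀

  Mult-+N : ∀ x c → Mult (x - c) → Mult (x + N - c)
  Mult-+N x c d = Mult-resp (regroup x N c) (Mult-+ d Mult-N)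
    where
    regroup : ∀ x N c → x - c + N ≡ x + N - c
    regroup = solve-∀

  Mult-+N⁻ : ∀ x c → Mult (x + N - c) → Mult (x - c)
  Mult-+N⁻ x c d = Mult-resp (regroup x N c) (Mult-sub d Mult-N)
    where
    regroup : ∀ x N c → x + N - c - N ≡ x - c
    regroup = solve-∀

  t-periodic : ∀ i j → Periodic (t n i j)
  t-periodic i j x with Mult? (x - i) | Mult? (x - j)
  ... | yes d | _ =
    t-at-i i j (x + N) (Mult-+N x i d) ∙ (shift-out x N i j ∙ cong (_+ N) (sym (t-at-i i j x d)))
  ... | no nd | yes d' =
    t-at-j i j (x + N) (nd ∘ Mult-+N⁻ x i) (Mult-+N x j d') ∙ (shift-out x N j i ∙ cong (_+ N) (sym (t-at-j i j x nd d')))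
  ... | no nd | no nd' =
    t-elsewhere i j (x + N) (nd ∘ Mult-+N⁻ x i) (nd' ∘ Mult-+N⁻ x j) ∙ cong (_+ N) (sym (t-elsewhere i j x nd nd'))

  private
    cancel : ∀ x i j → x - i + j - j ≡ x - i
    cancel = solve-∀
    restore : ∀ x i j → x - i + j - j + i ≡ x
    restore = solve-∀

  t-involutive : ∀ i j → ¬ Mult (j - i) → ∀ x → t n i j (t n i j x) ≡ x
  t-involutive i j j≢i x with Mult? (x - i) | Mult? (x - j)
  ... | yes d | _ =
    cong (t n i j) (t-at-i i j x d) ∙ (t-at-j i j (x - i + j) (j≢i ∘ back-to-ji) (Mult-resp (sym (cancel x i j)) d) ∙ restore x i j)
    where
    back-to-ji : Mult (x - i + j - i) → Mult (j - i)
    back-to-ji d' = Mult-resp (diff x i j) (Mult-sub d' d)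
      where
      diff : ∀ x i j → x - i + j - i - (x - i) ≡ j - i
      diff = solve-∀
  ... | no nd | yes d' =
    cong (t n i j) (t-at-j i j x nd d') ∙ (t-at-i i j (x - j + i) (Mult-resp (sym (cancel x j i)) d') ∙ restore x j i)
  ... | no nd | no nd' =
    cong (t n i j) (t-elsewhere i j x nd nd') ∙ t-elsewhere i j x nd nd'

  Bounded : (ℤ → ℤ) → Set
  Bounded F = ∀ x → (x ≤ᶻ F x) × (F x ≤ᶻ x + N)

  WindowBounded : (ℤ → ℤ) → Set
  WindowBounded F = ∀ p → InWindow p → (p ≤ᶻ F p) × (F p ≤ᶻ p + N)

  bounded-from-window : ∀ {F} → Periodic F → WindowBounded F → Bounded F
  bounded-from-window {F} per wb x with window-representative x
  ... | x' , x'∈W , d = subst (λ z → (z ≤ᶻ F z) × (F z ≤ᶻ z + N)) (sym x≡x'+K) (lo , hi)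
    where
    K = x - x'
    x≡x'+K : x ≡ x' + K
    x≡x'+K = split x x'
      where
      split : ∀ x x' → x ≡ x' + (x - x')
      split = solve-∀
    F-shift : F (x' + K) ≡ F x' + K
    F-shift = periodic-Mult {F} per d x'
    swap : ∀ x' N K → x' + N + K ≡ x' + K + N
    swap = solve-∀
    lo : x' + K ≤ᶻ F (x' + K)
    lo = subst (x' + K ≤ᶻ_) (sym F-shift) (ℤP.+-monoˡ-≤ K (proj₁ (wb x' x'∈W)))
    hi : F (x' + K) ≤ᶻ x' + K + N
    hi = subst₂ _≤ᶻ_ (sym F-shift) (swap x' N K) (ℤP.+-monoˡ-≤ K (proj₂ (wb x' x'∈W)))

  -- Window inversions
  --
  -- For a bounded periodic F an inversion (i , j) counted by ℓ has
  -- i < j < i + n, so j is either a window position c > i or c + n with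
  -- c < i.  Folding j back into the window identifies the inversions with
  -- the window inversions below.

  WInversion : (ℤ → ℤ) → ℤ × ℤ → Set
  WInversion F (i , c) = InWindow i × InWindow c × ((i < c × F c < F i) ⊎ (c < i × F c + N < F i))

  WInversion? : ∀ F P → Dec (WInversion F P)
  WInversion? F (i , c) = InWindow? i ×-dec (InWindow? c ×-dec
    (((i ℤP.<? c) ×-dec (F c ℤP.<? F i)) ⊎-dec ((c ℤP.<? i) ×-dec (F c + N ℤP.<? F i))))

  WInversion-irrefl : ∀ F p → ¬ WInversion F (p , p)
  WInversion-irrefl F p (_ , _ , inj₁ (p<p , _)) = irrefl p<p
  WInversion-irrefl F p (_ , _ , inj₂ (p<p , _)) = irrefl p<p

  HasWindowLength : (ℤ → ℤ) → ℕ → Set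
  HasWindowLength F m = Σ (List (ℤ × ℤ)) λ L →
    Unique L × (∀ P → P ∈ L → WInversion F P) × (∀ P → WInversion F P → P ∈ L) × length L ≡ m

  fold : ℤ → ℤ
  fold j with j ℤP.≤? N
  ... | yes _ = j
  ... | no _ = j - N

  fold-≤ : ∀ {j} → j ≤ᶻ N → fold j ≡ j
  fold-≤ {j} j≤N with j ℤP.≤? N
  ... | yes _ = refl
  ... | no j≰N = ⊥-elim (j≰N j≤N)

  fold-> : ∀ {j} → N < j → fold j ≡ j - N
  fold-> {j} N<j with j ℤP.≤? N
  ... | yes j≤N = ⊥-elim (irrefl (N<j <≤ j≤N))
  ... | no _ = refl

  private
    minus-plus : ∀ j N → j ≡ (j - N) + N
    minus-plus = solve-∀

    <+N⇒-N< : ∀ {i j} → j < i + N → j - N < i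
    <+N⇒-N< {i} {j} j<i+N = cancelʳ-< N (subst (_< i + N) (minus-plus j N) j<i+N)

  module WindowLength {F : ℤ → ℤ} (per : Periodic F) (bnd : Bounded F) where
    inversion-span : ∀ {i j} → F j < F i → j < i + N
    inversion-span {i} {j} Fj<Fi = proj₁ (bnd j) ≤< Fj<Fi <≤ proj₂ (bnd i)

    to-window : ∀ P → Inv n F P → WInversion F (proj₁ P , fold (proj₂ P))
    to-window (i , j) (1≤i , i≤N , i<j , Fj<Fi) with j ℤP.≤? N
    ... | yes j≤N = (1≤i , i≤N) , (1≤i ≤≤ ℤP.<⇒≤ i<j , j≤N) , inj₁ (i<j , Fj<Fi)
    ... | no j≰N =
      (1≤i , i≤N) , (1≤j-N , ℤP.<⇒≤ (j-N<i <≤ i≤N)) , inj₂ (j-N<i , subst (_< F i) Fj≡ Fj<Fi)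
      where
      j-N<i = <+N⇒-N< (inversion-span Fj<Fi)
      1≤j-N : + 1 ≤ᶻ j - N
      1≤j-N = cancelʳ-≤ N (subst (+ 1 + N ≤ᶻ_) (minus-plus j N) (ℤP.i<j⇒suc[i]≤j (ℤP.≰⇒> j≰N)))
      Fj≡ : F j ≡ F (j - N) + N
      Fj≡ = cong F (minus-plus j N) ∙ per (j - N)

    from-window : ∀ P → WInversion F P → Σ (ℤ × ℤ) λ Q → Inv n F Q × (proj₁ Q , fold (proj₂ Q)) ≡ P
    from-window (i , c) ((1≤i , i≤N) , (_ , c≤N) , inj₁ (i<c , Fc<Fi)) =
      (i , c) , (1≤i , i≤N , i<c , Fc<Fi) , cong (i ,_) (fold-≤ c≤N)
    from-window (i , c) ((1≤i , i≤N) , (1≤c , _) , inj₂ (c<i , Fc+N<Fi)) =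
      (i , c + N) , (1≤i , i≤N , i<c+N , subst (_< F i) (sym (per c)) Fc+N<Fi) ,
      cong (i ,_) (fold-> (<-pos+ 1≤c) ∙ +-cancel c N)
      where
      i<c+N : i < c + N
      i<c+N = ℤP.suc[i]≤j⇒i<j (subst₂ _≤ᶻ_ (ℤP.+-comm i (+ 1)) (ℤP.+-comm N c) (ℤP.+-mono-≤ i≤N 1≤c))

    fold-injective : ∀ P Q → Inv n F P → Inv n F Q →
      (proj₁ P , fold (proj₂ P)) ≡ (proj₁ Q , fold (proj₂ Q)) → P ≡ Q
    fold-injective (i , j) (i' , j') (_ , _ , i<j , Fj<Fi) (_ , _ , i<j' , Fj'<Fi) e
      with cong proj₁ e | cong proj₂ e
    ... | refl | e₂ with j ℤP.≤? N | j' ℤP.≤? N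
    ...   | yes _ | yes _ = cong (i ,_) e₂
    ...   | yes _ | no _ = ⊥-elim (irrefl (i<j << subst (_< i) (sym e₂) (<+N⇒-N< (inversion-span Fj'<Fi))))
    ...   | no _ | yes _ = ⊥-elim (irrefl (i<j' << subst (_< i) e₂ (<+N⇒-N< (inversion-span Fj<Fi))))
    ...   | no _ | no _ = cong (i ,_) (minus-plus j N ∙ (cong (_+ N) e₂ ∙ sym (minus-plus j' N)))

    window-length : ∀ {m} → HasLength n F m → HasWindowLength F m
    window-length (L , u , sound , complete , len) =
      map fold₂ L ,
      Counting.map-unique fold₂ u (λ P Q P∈ Q∈ → fold-injective P Q (sound P P∈) (sound Q Q∈)) ,
      image-sound , image-complete , LP.length-map fold₂ L ∙ len
      where
      fold₂ : ℤ × ℤ → ℤ × ℤ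
      fold₂ (i , j) = i , fold j
      image-sound : ∀ P → P ∈ map fold₂ L → WInversion F P
      image-sound P P∈ with ∈ₚ.∈-map⁻ fold₂ P∈
      ... | Q , Q∈ , refl = to-window Q (sound Q Q∈)
      image-complete : ∀ P → WInversion F P → P ∈ map fold₂ L
      image-complete P wi with from-window P wi
      ... | Q , inv , refl = ∈ₚ.∈-map⁺ fold₂ (complete Q inv)

  -- Exchange arguments
  --
  -- To compare the lengths of two windows f and h that differ by swapping
  -- the entries at two positions x, y, map the window inversions of f into
  -- those of h: keep the inversions of h, and send the others through the
  -- swap τ of x and y.  Inversions of h outside the image then show that
  -- ℓ(h) exceeds ℓ(f).

  module Swap (x y : ℤ) (x≢y : x ≢ y) where
    data Position (p : ℤ) : Set where
      at-x : p ≡ x → Position p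
      at-y : p ≡ y → Position p
      elsewhere : p ≢ x → p ≢ y → Position p

    position : ∀ p → Position p
    position p with p ℤP.≟ x | p ℤP.≟ y
    ... | yes e | _ = at-x e
    ... | no _ | yes e = at-y e
    ... | no p≢x | no p≢y = elsewhere p≢x p≢y

    τ : ℤ → ℤ
    τ p with p ℤP.≟ x | p ℤP.≟ y
    ... | yes _ | _ = y
    ... | no _ | yes _ = x
    ... | no _ | no _ = p

    τ-x : τ x ≡ y
    τ-x with x ℤP.≟ x
    ... | yes _ = refl
    ... | no x≢x = ⊥-elim (x≢x refl)

    τ-y : τ y ≡ x
    τ-y with y ℤP.≟ x | y ℤP.≟ y
    ... | yes y≡x | _ = ⊥-elim (x≢y (sym y≡x))
    ... | no _ | yes _ = refl
    ... | no _ | no y≢y = ⊥-elim (y≢y refl)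

    τ-other : ∀ {p} → p ≢ x → p ≢ y → τ p ≡ p
    τ-other {p} p≢x p≢y with p ℤP.≟ x | p ℤP.≟ y
    ... | yes e | _ = ⊥-elim (p≢x e)
    ... | no _ | yes e = ⊥-elim (p≢y e)
    ... | no _ | no _ = refl

    τ-involutive : ∀ p → τ (τ p) ≡ p
    τ-involutive p with position p
    ... | at-x refl = cong τ τ-x ∙ τ-y
    ... | at-y refl = cong τ τ-y ∙ τ-x
    ... | elsewhere p≢x p≢y = cong τ (τ-other p≢x p≢y) ∙ τ-other p≢x p≢y

    τ-injective : ∀ {p q} → τ p ≡ τ q → p ≡ q
    τ-injective {p} {q} e = sym (τ-involutive p) ∙ (cong τ e ∙ τ-involutive q)

    τ₂ : ℤ × ℤ → ℤ × ℤ
    τ₂ (i , c) = (τ i , τ c)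

    τ₂-involutive : ∀ P → τ₂ (τ₂ P) ≡ P
    τ₂-involutive (i , c) = cong₂ _,_ (τ-involutive i) (τ-involutive c)

    τ-window : InWindow x → InWindow y → ∀ {p} → InWindow p → InWindow (τ p)
    τ-window x∈W y∈W {p} p∈W with position p
    ... | at-x refl = subst InWindow (sym τ-x) y∈W
    ... | at-y refl = subst InWindow (sym τ-y) x∈W
    ... | elsewhere p≢x p≢y = subst InWindow (sym (τ-other p≢x p≢y)) p∈W

    exchange : ∀ f h →
      (hits-h : ∀ P → WInversion f P → ¬ WInversion h P → WInversion h (τ₂ P)) →
      (leaves-f : ∀ P → WInversion f P → ¬ WInversion h P → ¬ WInversion f (τ₂ P)) →
      (es : List (ℤ × ℤ)) → Unique es → All (WInversion h) es →
      (∀ e → e ∈ es → ¬ WInversion f e × ¬ WInversion f (τ₂ e)) →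
      ∀ {m m'} → HasWindowLength f m → HasWindowLength h m' → length es ℕ.+ m ℕ.≤ m'
    exchange f h hits-h leaves-f es ues es-h es-new {m} {m'} (LA , uA , sA , _ , lenA) (LB , _ , _ , cB , lenB) =
      subst₂ (λ a b → length es ℕ.+ a ℕ.≤ b) lenA lenB
        (Counting.injection-count φ es uA sA cB φ-into φ-injective ues es-h outside)
      where
      φ : ℤ × ℤ → ℤ × ℤ
      φ P with WInversion? h P
      ... | yes _ = P
      ... | no _ = τ₂ P

      φ-cases : ∀ P → (WInversion h P × φ P ≡ P) ⊎ (¬ WInversion h P × φ P ≡ τ₂ P)
      φ-cases P with WInversion? h P
      ... | yes hP = inj₁ (hP , refl)
      ... | no ¬hP = inj₂ (¬hP , refl)

      φ-into : ∀ P → WInversion f P → WInversion h (φ P)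
      φ-into P fP with φ-cases P
      ... | inj₁ (hP , e) = subst (WInversion h) (sym e) hP
      ... | inj₂ (¬hP , e) = subst (WInversion h) (sym e) (hits-h P fP ¬hP)

      φ-injective : ∀ P Q → WInversion f P → WInversion f Q → φ P ≡ φ Q → P ≡ Q
      φ-injective P Q fP fQ e with φ-cases P | φ-cases Q
      ... | inj₁ (_ , eP) | inj₁ (_ , eQ) = sym eP ∙ (e ∙ eQ)
      ... | inj₂ (_ , eP) | inj₂ (_ , eQ) =
        sym (τ₂-involutive P) ∙ (cong τ₂ (sym eP ∙ (e ∙ eQ)) ∙ τ₂-involutive Q)
      ... | inj₁ (_ , eP) | inj₂ (¬hQ , eQ) =
        ⊥-elim (leaves-f Q fQ ¬hQ (subst (WInversion f) (sym eP ∙ (e ∙ eQ)) fP))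
      ... | inj₂ (¬hP , eP) | inj₁ (_ , eQ) =
        ⊥-elim (leaves-f P fP ¬hP (subst (WInversion f) (sym eQ ∙ (sym e ∙ eP)) fQ))

      outside : ∀ P → WInversion f P → All (φ P ≢_) es
      outside P fP = All.tabulate λ {e} e∈ φP≡e → hit e e∈ φP≡e
        where
        hit : ∀ e → e ∈ es → φ P ≡ e → ⊥
        hit e e∈ φP≡e with φ-cases P
        ... | inj₁ (_ , eP) = proj₁ (es-new e e∈) (subst (WInversion f) (sym eP ∙ φP≡e) fP)
        ... | inj₂ (_ , eP) = proj₂ (es-new e e∈)
                (subst (WInversion f) (sym (τ₂-involutive P) ∙ cong τ₂ (sym eP ∙ φP≡e)) fP)

  plain : ∀ F {i c} → InWindow i → InWindow c → i < c → F c < F i → WInversion F (i , c)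
  plain F i∈W c∈W i<c Fc<Fi = i∈W , c∈W , inj₁ (i<c , Fc<Fi)

  shifted : ∀ F {i c} → InWindow i → InWindow c → c < i → F c + N < F i → WInversion F (i , c)
  shifted F i∈W c∈W c<i Fc+N<Fi = i∈W , c∈W , inj₂ (c<i , Fc+N<Fi)

  -- Swapping an ascent f x < f y (x < y) across an intermediate value
  -- f x < f s < f y (x < s < y) adds at least two inversions: in Bruhat
  -- order such a swap is never a cover.
  module IntermediateValueSwap (f h : ℤ → ℤ) (x y s : ℤ)
      (x∈W : InWindow x) (y∈W : InWindow y) (s∈W : InWindow s)
      (x<s : x < s) (s<y : s < y) (fx<fs : f x < f s) (fs<fy : f s < f y)
      (hx : h x ≡ f y) (hy : h y ≡ f x)
      (h-other : ∀ p → InWindow p → p ≢ x → p ≢ y → h p ≡ f p)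
      (f-bnd : WindowBounded f) (h-bnd : WindowBounded h) where
    private
      x<y : x < y
      x<y = x<s << s<y
      fx<fy : f x < f y
      fx<fy = fx<fs << fs<fy
      x≢y : x ≢ y
      x≢y = ℤP.<⇒≢ x<y

    open Swap x y x≢y

    private
      h≡fτ : ∀ p → InWindow p → h p ≡ f (τ p)
      h≡fτ p p∈W with position p
      ... | at-x refl = hx ∙ cong f (sym τ-x)
      ... | at-y refl = hy ∙ cong f (sym τ-y)
      ... | elsewhere p≢x p≢y = h-other p p∈W p≢x p≢y ∙ cong f (sym (τ-other p≢x p≢y))

      hτ≡f : ∀ p → InWindow p → h (τ p) ≡ f p
      hτ≡f p p∈W = h≡fτ (τ p) (τ-window x∈W y∈W p∈W) ∙ cong f (τ-involutive p)

      fy≤x+N : f y ≤ᶻ x + N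
      fy≤x+N = subst (_≤ᶻ x + N) hx (proj₂ (h-bnd x x∈W))
      y≤fx : y ≤ᶻ f x
      y≤fx = subst (y ≤ᶻ_) hy (proj₁ (h-bnd y y∈W))

      reversed-plain : ∀ i c → InWindow i → InWindow c → i < c → τ c < τ i → f c < f i →
        ¬ WInversion h (i , c) → ⊥
      reversed-plain i c i∈W c∈W i<c τc<τi fc<fi ¬h with position i | position c
      ... | at-x refl | at-x refl = irrefl i<c
      ... | at-x refl | at-y refl = ℤP.<-asym fx<fy fc<fi
      ... | at-x refl | elsewhere c≢x c≢y =
        ¬h (plain h i∈W c∈W i<c (subst₂ _<_ (sym (h-other c c∈W c≢x c≢y)) (sym hx) (fc<fi << fx<fy)))
      ... | at-y refl | at-x refl = ℤP.<-asym x<y i<c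
      ... | at-y refl | at-y refl = irrefl i<c
      ... | at-y refl | elsewhere c≢x c≢y = irrefl (subst₂ _<_ (τ-other c≢x c≢y) τ-y τc<τi << x<y << i<c)
      ... | elsewhere i≢x i≢y | at-x refl = irrefl (i<c << x<y << subst₂ _<_ τ-x (τ-other i≢x i≢y) τc<τi)
      ... | elsewhere i≢x i≢y | at-y refl =
        ¬h (plain h i∈W c∈W i<c (subst₂ _<_ (sym hy) (sym (h-other i i∈W i≢x i≢y)) (fx<fy << fc<fi)))
      ... | elsewhere i≢x i≢y | elsewhere c≢x c≢y =
        ℤP.<-asym i<c (subst₂ _<_ (τ-other c≢x c≢y) (τ-other i≢x i≢y) τc<τi)

      preserved-shifted : ∀ i c → InWindow i → InWindow c → c < i → τ i < τ c → f c + N < f i → ⊥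
      preserved-shifted i c i∈W c∈W c<i τi<τc fc+N<fi with position i | position c
      ... | at-x refl | at-x refl = irrefl c<i
      ... | at-y refl | at-y refl = irrefl c<i
      ... | at-y refl | at-x refl =
        irrefl (fc+N<fi <≤ fy≤x+N <≤ ℤP.+-monoˡ-≤ N (proj₁ (f-bnd x x∈W)))
      ... | at-y refl | elsewhere c≢x c≢y =
        irrefl (fc+N<fi <≤ fy≤x+N << ℤP.+-monoˡ-< N (subst₂ _<_ τ-y (τ-other c≢x c≢y) τi<τc) <≤ ℤP.+-monoˡ-≤ N (proj₁ (f-bnd c c∈W)))
      ... | elsewhere i≢x i≢y | at-x refl =
        irrefl (fc+N<fi <≤ proj₂ (f-bnd i i∈W) << ℤP.+-monoˡ-< N (subst₂ _<_ (τ-other i≢x i≢y) τ-x τi<τc) <≤ ℤP.+-monoˡ-≤ N y≤fx)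
      ... | at-x refl | at-y refl = ℤP.<-asym x<y c<i
      ... | at-x refl | elsewhere c≢x c≢y = irrefl (x<y << subst₂ _<_ τ-x (τ-other c≢x c≢y) τi<τc << c<i)
      ... | elsewhere i≢x i≢y | at-y refl = irrefl (x<y << c<i << subst₂ _<_ (τ-other i≢x i≢y) τ-y τi<τc)
      ... | elsewhere i≢x i≢y | elsewhere c≢x c≢y =
        ℤP.<-asym c<i (subst₂ _<_ (τ-other i≢x i≢y) (τ-other c≢x c≢y) τi<τc)

      reversed-plain-not-shifted : ∀ i c → InWindow i → InWindow c → i < c → τ c < τ i → f c < f i →
        f (τ c) + N < f (τ i) → ⊥
      reversed-plain-not-shifted i c i∈W c∈W i<c τc<τi fc<fi w with position i | position c
      ... | at-x refl | at-x refl = irrefl i<c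
      ... | at-y refl | at-y refl = irrefl i<c
      ... | at-x refl | at-y refl = ℤP.<-asym fx<fy fc<fi
      ... | at-x refl | elsewhere c≢x c≢y =
        irrefl (subst₂ (λ u z → f u + N < f z) (τ-other c≢x c≢y) τ-x w <≤ fy≤x+N << ℤP.+-monoˡ-< N i<c <≤ ℤP.+-monoˡ-≤ N (proj₁ (f-bnd c c∈W)))
      ... | elsewhere i≢x i≢y | at-y refl =
        irrefl (subst₂ (λ u z → f u + N < f z) τ-y (τ-other i≢x i≢y) w <≤ proj₂ (f-bnd i i∈W) << ℤP.+-monoˡ-< N i<c <≤ ℤP.+-monoˡ-≤ N y≤fx)
      ... | at-y refl | at-x refl = ℤP.<-asym x<y i<c
      ... | at-y refl | elsewhere c≢x c≢y = irrefl (subst₂ _<_ (τ-other c≢x c≢y) τ-y τc<τi << x<y << i<c)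
      ... | elsewhere i≢x i≢y | at-x refl = irrefl (i<c << x<y << subst₂ _<_ τ-x (τ-other i≢x i≢y) τc<τi)
      ... | elsewhere i≢x i≢y | elsewhere c≢x c≢y =
        ℤP.<-asym i<c (subst₂ _<_ (τ-other c≢x c≢y) (τ-other i≢x i≢y) τc<τi)

      hits-h : ∀ P → WInversion f P → ¬ WInversion h P → WInversion h (τ₂ P)
      hits-h (i , c) (i∈W , c∈W , inj₂ (c<i , fc+N<fi)) ¬h with ℤP.<-cmp (τ i) (τ c)
      ... | tri< τi<τc _ _ = ⊥-elim (preserved-shifted i c i∈W c∈W c<i τi<τc fc+N<fi)
      ... | tri≈ _ e _ = ⊥-elim (irrefl (subst (c <_) (τ-injective e) c<i))
      ... | tri> _ _ τc<τi = shifted h (τ-window x∈W y∈W i∈W) (τ-window x∈W y∈W c∈W) τc<τi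
              (subst₂ (λ u z → u + N < z) (sym (hτ≡f c c∈W)) (sym (hτ≡f i i∈W)) fc+N<fi)
      hits-h (i , c) (i∈W , c∈W , inj₁ (i<c , fc<fi)) ¬h with ℤP.<-cmp (τ i) (τ c)
      ... | tri< τi<τc _ _ = plain h (τ-window x∈W y∈W i∈W) (τ-window x∈W y∈W c∈W) τi<τc
              (subst₂ _<_ (sym (hτ≡f c c∈W)) (sym (hτ≡f i i∈W)) fc<fi)
      ... | tri≈ _ e _ = ⊥-elim (irrefl (subst (i <_) (sym (τ-injective e)) i<c))
      ... | tri> _ _ τc<τi = ⊥-elim (reversed-plain i c i∈W c∈W i<c τc<τi fc<fi ¬h)

      leaves-f : ∀ P → WInversion f P → ¬ WInversion h P → ¬ WInversion f (τ₂ P)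
      leaves-f (i , c) (i∈W , c∈W , inj₁ (i<c , _)) ¬h (_ , _ , inj₁ (_ , w)) =
        ¬h (plain h i∈W c∈W i<c (subst₂ _<_ (sym (h≡fτ c c∈W)) (sym (h≡fτ i i∈W)) w))
      leaves-f (i , c) (i∈W , c∈W , inj₂ (c<i , fc+N<fi)) ¬h (_ , _ , inj₁ (τi<τc , _)) =
        preserved-shifted i c i∈W c∈W c<i τi<τc fc+N<fi
      leaves-f (i , c) (i∈W , c∈W , inj₂ (c<i , _)) ¬h (_ , _ , inj₂ (_ , w)) =
        ¬h (shifted h i∈W c∈W c<i (subst₂ (λ u z → u + N < z) (sym (h≡fτ c c∈W)) (sym (h≡fτ i i∈W)) w))
      leaves-f (i , c) (i∈W , c∈W , inj₁ (i<c , fc<fi)) ¬h (_ , _ , inj₂ (τc<τi , w)) =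
        reversed-plain-not-shifted i c i∈W c∈W i<c τc<τi fc<fi w

      s≢x : s ≢ x
      s≢x = >⇒≢ x<s
      s≢y : s ≢ y
      s≢y = ℤP.<⇒≢ s<y

      new : List (ℤ × ℤ)
      new = (x , y) ∷ (x , s) ∷ []

      new-unique : Unique new
      new-unique = ((λ e → s≢y (sym (cong proj₂ e))) ∷ []) ∷ ([] ∷ [])

      new-h : All (WInversion h) new
      new-h = plain h x∈W y∈W x<y (subst₂ _<_ (sym hy) (sym hx) fx<fy)
            ∷ plain h x∈W s∈W x<s (subst₂ _<_ (sym (h-other s s∈W s≢x s≢y)) (sym hx) fs<fy) ∷ []

      ¬f-xy : ¬ WInversion f (x , y)
      ¬f-xy (_ , _ , inj₁ (_ , fy<fx)) = ℤP.<-asym fx<fy fy<fx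
      ¬f-xy (_ , _ , inj₂ (y<x , _)) = ℤP.<-asym x<y y<x
      ¬f-yx : ¬ WInversion f (y , x)
      ¬f-yx (_ , _ , inj₁ (y<x , _)) = ℤP.<-asym x<y y<x
      ¬f-yx (_ , _ , inj₂ (_ , fx+N<fy)) = irrefl (fx+N<fy <≤ fy≤x+N <≤ ℤP.+-monoˡ-≤ N (proj₁ (f-bnd x x∈W)))
      ¬f-xs : ¬ WInversion f (x , s)
      ¬f-xs (_ , _ , inj₁ (_ , fs<fx)) = ℤP.<-asym fx<fs fs<fx
      ¬f-xs (_ , _ , inj₂ (s<x , _)) = ℤP.<-asym x<s s<x
      ¬f-ys : ¬ WInversion f (y , s)
      ¬f-ys (_ , _ , inj₁ (y<s , _)) = ℤP.<-asym s<y y<s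
      ¬f-ys (_ , _ , inj₂ (_ , fs+N<fy)) =
        irrefl (fs+N<fy <≤ fy≤x+N << ℤP.+-monoˡ-< N x<s <≤ ℤP.+-monoˡ-≤ N (proj₁ (f-bnd s s∈W)))

      new-fresh : ∀ e → e ∈ new → ¬ WInversion f e × ¬ WInversion f (τ₂ e)
      new-fresh _ (here refl) = ¬f-xy , subst (¬_ ∘ WInversion f) (sym (cong₂ _,_ τ-x τ-y)) ¬f-yx
      new-fresh _ (there (here refl)) =
        ¬f-xs , subst (¬_ ∘ WInversion f) (sym (cong₂ _,_ τ-x (τ-other s≢x s≢y))) ¬f-ys

    intermediate-value-swap : ∀ {m m'} → HasWindowLength f m → HasWindowLength h m' → 2 ℕ.+ m ℕ.≤ m'
    intermediate-value-swap = exchange f h hits-h leaves-f new new-unique new-h new-fresh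

  -- Swapping the entries at positions y < x of the window, where
  -- f x < f y + n, so that h x = f y + n and h y = f x - n, adds at least
  -- one inversion.  (This is the ascent f (x - n) < f y of f at positions
  -- x - n < y being undone, i.e. h = f ∘ t_{x-n,y}.)
  module ShiftedAscentSwap (f h : ℤ → ℤ) (x y : ℤ) (x∈W : InWindow x) (y∈W : InWindow y)
      (y<x : y < x) (fx<fy+N : f x < f y + N)
      (hx : h x ≡ f y + N) (hy+N : h y + N ≡ f x)
      (h-other : ∀ p → InWindow p → p ≢ x → p ≢ y → h p ≡ f p)
      (f-bnd : WindowBounded f) (h-bnd : WindowBounded h) where
    private
      x≢y : x ≢ y
      x≢y = >⇒≢ y<x

    open Swap x y x≢y

    private
      fy≤x : f y ≤ᶻ x
      fy≤x = cancelʳ-≤ N (subst (_≤ᶻ x + N) hx (proj₂ (h-bnd x x∈W)))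
      y+N≤fx : y + N ≤ᶻ f x
      y+N≤fx = subst (y + N ≤ᶻ_) hy+N (ℤP.+-monoˡ-≤ N (proj₁ (h-bnd y y∈W)))
      hy<fy : h y < f y
      hy<fy = cancelʳ-< N (subst (_< f y + N) (sym hy+N) fx<fy+N)
      hy<fx : h y < f x
      hy<fx = subst (h y <_) hy+N (<-+pos 1≤N)
      h≡f : ∀ {p} → InWindow p → p ≢ x → p ≢ y → f p ≡ h p
      h≡f {p} p∈W p≢x p≢y = sym (h-other p p∈W p≢x p≢y)

      keep-other : ∀ i c → InWindow i → InWindow c → i ≢ x → i ≢ y → c ≢ x → c ≢ y →
        WInversion f (i , c) → WInversion h (i , c)
      keep-other i c i∈W c∈W i≢x i≢y c≢x c≢y (_ , _ , inj₁ (i<c , fc<fi)) =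
        plain h i∈W c∈W i<c (subst₂ _<_ (h≡f c∈W c≢x c≢y) (h≡f i∈W i≢x i≢y) fc<fi)
      keep-other i c i∈W c∈W i≢x i≢y c≢x c≢y (_ , _ , inj₂ (c<i , fc+N<fi)) =
        shifted h i∈W c∈W c<i (subst₂ (λ u z → u + N < z) (h≡f c∈W c≢x c≢y) (h≡f i∈W i≢x i≢y) fc+N<fi)

      keep-x-c : ∀ c → InWindow c → c ≢ x → c ≢ y → WInversion f (x , c) → WInversion h (x , c)
      keep-x-c c c∈W c≢x c≢y (_ , _ , inj₁ (x<c , fc<fx)) =
        plain h x∈W c∈W x<c (subst₂ _<_ (h≡f c∈W c≢x c≢y) (sym hx) (fc<fx << fx<fy+N))
      keep-x-c c c∈W c≢x c≢y (_ , _ , inj₂ (c<x , fc+N<fx)) =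
        shifted h x∈W c∈W c<x (subst₂ (λ u z → u + N < z) (h≡f c∈W c≢x c≢y) (sym hx) (fc+N<fx << fx<fy+N))

      keep-i-y : ∀ i → InWindow i → i ≢ x → i ≢ y → WInversion f (i , y) → WInversion h (i , y)
      keep-i-y i i∈W i≢x i≢y (_ , _ , inj₁ (i<y , fy<fi)) =
        plain h i∈W y∈W i<y (subst (h y <_) (h≡f i∈W i≢x i≢y) (hy<fy << fy<fi))
      keep-i-y i i∈W i≢x i≢y (_ , _ , inj₂ (y<i , fy+N<fi)) =
        shifted h i∈W y∈W y<i (subst₂ _<_ (sym hy+N) (h≡f i∈W i≢x i≢y) (fx<fy+N << fy+N<fi))

      move-i-x : ∀ i → InWindow i → i ≢ x → i ≢ y → WInversion f (i , x) → WInversion h (i , y)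
      move-i-x i i∈W i≢x i≢y (_ , _ , inj₁ (i<x , fx<fi)) with ℤP.<-cmp i y
      ... | tri< i<y _ _ = plain h i∈W y∈W i<y (subst (h y <_) (h≡f i∈W i≢x i≢y) (hy<fx << fx<fi))
      ... | tri≈ _ i≡y _ = ⊥-elim (i≢y i≡y)
      ... | tri> _ _ y<i = shifted h i∈W y∈W y<i (subst₂ _<_ (sym hy+N) (h≡f i∈W i≢x i≢y) fx<fi)
      move-i-x i i∈W i≢x i≢y (_ , _ , inj₂ (x<i , fx+N<fi)) =
        shifted h i∈W y∈W (y<x << x<i) (subst₂ _<_ (sym hy+N) (h≡f i∈W i≢x i≢y) (<-+pos 1≤N << fx+N<fi))

      move-i-x-fresh : ∀ i → InWindow i → i ≢ x → i ≢ y → WInversion f (i , x) →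
        ¬ WInversion h (i , x) → ¬ WInversion f (i , y)
      move-i-x-fresh i i∈W i≢x i≢y (_ , _ , inj₁ (i<x , fx<fi)) _ (_ , _ , inj₁ (i<y , _)) =
        irrefl (fx<fi <≤ proj₂ (f-bnd i i∈W) << ℤP.+-monoˡ-< N i<y <≤ y+N≤fx)
      move-i-x-fresh i i∈W i≢x i≢y (_ , _ , inj₁ (i<x , _)) ¬h (_ , _ , inj₂ (y<i , fy+N<fi)) =
        ¬h (plain h i∈W x∈W i<x (subst₂ _<_ (sym hx) (h≡f i∈W i≢x i≢y) fy+N<fi))
      move-i-x-fresh i i∈W i≢x i≢y (_ , _ , inj₂ (x<i , fx+N<fi)) _ _ =
        irrefl (fx+N<fi <≤ proj₂ (f-bnd i i∈W) <≤ ℤP.+-monoˡ-≤ N (proj₂ i∈W) << ℤP.+-monoˡ-< N (<-pos+ (proj₁ y∈W)) <≤ ℤP.+-monoˡ-≤ N y+N≤fx)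

      move-y-c : ∀ c → InWindow c → c ≢ x → c ≢ y → WInversion f (y , c) → WInversion h (x , c)
      move-y-c c c∈W c≢x c≢y (_ , _ , inj₁ (y<c , fc<fy)) with ℤP.<-cmp x c
      ... | tri< x<c _ _ = plain h x∈W c∈W x<c (subst₂ _<_ (h≡f c∈W c≢x c≢y) (sym hx) (fc<fy << <-+pos 1≤N))
      ... | tri≈ _ x≡c _ = ⊥-elim (c≢x (sym x≡c))
      ... | tri> _ _ c<x = shifted h x∈W c∈W c<x (subst₂ (λ u z → u + N < z) (h≡f c∈W c≢x c≢y) (sym hx) (ℤP.+-monoˡ-< N fc<fy))
      move-y-c c c∈W c≢x c≢y (_ , _ , inj₂ (c<y , fc+N<fy)) =
        shifted h x∈W c∈W (c<y << y<x) (subst₂ (λ u z → u + N < z) (h≡f c∈W c≢x c≢y) (sym hx) (fc+N<fy << <-+pos 1≤N))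

      move-y-c-fresh : ∀ c → InWindow c → c ≢ x → c ≢ y → WInversion f (y , c) →
        ¬ WInversion h (y , c) → ¬ WInversion f (x , c)
      move-y-c-fresh c c∈W c≢x c≢y (_ , _ , inj₂ (c<y , fc+N<fy)) _ _ =
        irrefl (fc+N<fy <≤ fy≤x <≤ proj₂ x∈W << <-pos+ (proj₁ c∈W ≤≤ proj₁ (f-bnd c c∈W)))
      move-y-c-fresh c c∈W c≢x c≢y (_ , _ , inj₁ (y<c , fc<fy)) _ (_ , _ , inj₁ (x<c , _)) =
        irrefl (fc<fy <≤ fy≤x << x<c <≤ proj₁ (f-bnd c c∈W))
      move-y-c-fresh c c∈W c≢x c≢y (_ , _ , inj₁ (y<c , _)) ¬h (_ , _ , inj₂ (c<x , fc+N<fx)) =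
        ¬h (plain h y∈W c∈W y<c (subst (_< h y) (h≡f c∈W c≢x c≢y) (cancelʳ-< N (subst (f c + N <_) (sym hy+N) fc+N<fx))))

      ¬f-xy : ¬ WInversion f (x , y)
      ¬f-xy (_ , _ , inj₁ (x<y , _)) = ℤP.<-asym y<x x<y
      ¬f-xy (_ , _ , inj₂ (_ , fy+N<fx)) = ℤP.<-asym fx<fy+N fy+N<fx
      ¬f-yx : ¬ WInversion f (y , x)
      ¬f-yx (_ , _ , inj₁ (_ , fx<fy)) =
        irrefl (fx<fy <≤ fy≤x <≤ proj₂ x∈W << <-pos+ (proj₁ y∈W) <≤ y+N≤fx)
      ¬f-yx (_ , _ , inj₂ (x<y , _)) = ℤP.<-asym y<x x<y

      fate : ∀ P → WInversion f P →
        WInversion h P ⊎ (WInversion h (τ₂ P) × (¬ WInversion h P → ¬ WInversion f (τ₂ P)))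
      fate (i , c) fP with position i | position c
      ... | at-x refl | at-x refl = ⊥-elim (WInversion-irrefl f x fP)
      ... | at-y refl | at-y refl = ⊥-elim (WInversion-irrefl f y fP)
      ... | at-x refl | at-y refl = ⊥-elim (¬f-xy fP)
      ... | at-y refl | at-x refl = ⊥-elim (¬f-yx fP)
      ... | at-x refl | elsewhere c≢x c≢y = inj₁ (keep-x-c c (proj₁ (proj₂ fP)) c≢x c≢y fP)
      ... | elsewhere i≢x i≢y | at-y refl = inj₁ (keep-i-y i (proj₁ fP) i≢x i≢y fP)
      ... | elsewhere i≢x i≢y | elsewhere c≢x c≢y =
        inj₁ (keep-other i c (proj₁ fP) (proj₁ (proj₂ fP)) i≢x i≢y c≢x c≢y fP)
      ... | elsewhere i≢x i≢y | at-x refl rewrite τ-other i≢x i≢y | τ-x =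
        inj₂ (move-i-x i (proj₁ fP) i≢x i≢y fP , move-i-x-fresh i (proj₁ fP) i≢x i≢y fP)
      ... | at-y refl | elsewhere c≢x c≢y rewrite τ-y | τ-other c≢x c≢y =
        inj₂ (move-y-c c (proj₁ (proj₂ fP)) c≢x c≢y fP , move-y-c-fresh c (proj₁ (proj₂ fP)) c≢x c≢y fP)

      hits-h : ∀ P → WInversion f P → ¬ WInversion h P → WInversion h (τ₂ P)
      hits-h P fP ¬h with fate P fP
      ... | inj₁ hP = ⊥-elim (¬h hP)
      ... | inj₂ (hτP , _) = hτP

      leaves-f : ∀ P → WInversion f P → ¬ WInversion h P → ¬ WInversion f (τ₂ P)
      leaves-f P fP ¬h with fate P fP
      ... | inj₁ hP = ⊥-elim (¬h hP)
      ... | inj₂ (_ , fresh) = fresh ¬h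

      new-fresh : ∀ e → e ∈ (x , y) ∷ [] → ¬ WInversion f e × ¬ WInversion f (τ₂ e)
      new-fresh _ (here refl) = ¬f-xy , subst (¬_ ∘ WInversion f) (sym (cong₂ _,_ τ-x τ-y)) ¬f-yx

    shifted-ascent-swap : ∀ {m m'} → HasWindowLength f m → HasWindowLength h m' → 1 ℕ.+ m ℕ.≤ m'
    shifted-ascent-swap = exchange f h hits-h leaves-f ((x , y) ∷ []) ([] ∷ [])
      (shifted h x∈W y∈W y<x (subst₂ _<_ (sym hy+N) (sym hx) fx<fy+N) ∷ []) new-fresh

  -- Composing with a transposition

  t-symmetric : ∀ i j → ¬ Mult (i - j) → ∀ x → t n i j x ≡ t n j i x
  t-symmetric i j i≢j x with Mult? (x - i) | Mult? (x - j)
  ... | yes di | yes dj = ⊥-elim (i≢j (Mult-trans {i} {x} {j} (Mult-flip {x} di) dj))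
  ... | yes di | no ¬dj = t-at-i i j x di ∙ sym (t-at-j j i x ¬dj di)
  ... | no ¬di | yes dj = t-at-j i j x ¬di dj ∙ sym (t-at-i j i x dj)
  ... | no ¬di | no ¬dj = t-elsewhere i j x ¬di ¬dj ∙ sym (t-elsewhere j i x ¬dj ¬di)

  -- h = v ∘ t_{c r} for a window position r: on the window, h exchanges the
  -- entries of v at r and at the representative c' of c, up to the shift
  -- K = c - c'.
  module ComposedWithTransposition (v : ℤ → ℤ) (v-per : Periodic v) (c r : ℤ) (r∈W : InWindow r)
      (c≢r : ¬ Mult (c - r)) (h : ℤ → ℤ) (h≗ : h ≗ (λ x → v (t n c r x))) where
    c' : ℤ
    c' = proj₁ (window-representative c)
    c'∈W : InWindow c'
    c'∈W = proj₁ (proj₂ (window-representative c))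
    dc : Mult (c - c')
    dc = proj₂ (proj₂ (window-representative c))

    K : ℤ
    K = c - c'

    c'≢r : c' ≢ r
    c'≢r refl = c≢r dc

    private
      module T = TranspositionOnWindow c r c' r c'∈W r∈W dc (Mult-x-x r) c'≢r
      as-shift : ∀ c' c r → c' - c + r ≡ r + - (c - c')
      as-shift = solve-∀
      as-shift' : ∀ r c c' → r - r + c ≡ c' + (c - c')
      as-shift' = solve-∀

    h-c' : h c' ≡ v r + - K
    h-c' = h≗ c' ∙ (cong v (T.t-a' ∙ as-shift c' c r) ∙ periodic-Mult {v} v-per (Mult-neg dc) r)

    h-r : h r ≡ v c' + K
    h-r = h≗ r ∙ (cong v (T.t-b' ∙ as-shift' r c c') ∙ periodic-Mult {v} v-per dc c')

    h-other : ∀ p → InWindow p → p ≢ c' → p ≢ r → h p ≡ v p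
    h-other p p∈W p≢c' p≢r = h≗ p ∙ cong v (T.t-other p p∈W p≢c' p≢r)

  -- Children are larger in reverse-lexicographic order

  RevLexAbove : (ℤ → ℤ) → (ℤ → ℤ) → Set
  RevLexAbove g h = Σ ℤ λ q → InWindow q × g q < h q × (∀ p → q < p → p ≤ᶻ N → h p ≡ g p)

  module AtMaximalInversion (k : ℕ) (g : ℤ → ℤ) (g∈B : InBound k n g) (r s : ℤ) (mi : MaxInv n g r s) where
    g-per : Periodic g
    g-per = proj₁ (proj₁ g∈B)
    g-inj : ∀ {a b} → g a ≡ g b → a ≡ b
    g-inj = proj₁ (proj₂ (proj₁ g∈B))
    g-bnd : Bounded g
    g-bnd = proj₁ (proj₂ g∈B)

    1≤r : + 1 ≤ᶻ r
    1≤r = proj₁ (proj₁ mi)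
    r<s : r < s
    r<s = proj₁ (proj₂ (proj₁ mi))
    s≤N : s ≤ᶻ N
    s≤N = proj₁ (proj₂ (proj₂ (proj₁ mi)))
    gs<gr : g s < g r
    gs<gr = proj₂ (proj₂ (proj₂ (proj₁ mi)))
    r∈W : InWindow r
    r∈W = 1≤r , ℤP.<⇒≤ (r<s <≤ s≤N)
    s∈W : InWindow s
    s∈W = (1≤r ≤≤ ℤP.<⇒≤ r<s) , s≤N
    r≢s : r ≢ s
    r≢s = ℤP.<⇒≢ r<s

    -- maximality of (r , s): g r < g j for every window position j > s
    beyond-s-ascent : ∀ j → InWindow j → s < j → g r < g j
    beyond-s-ascent j (_ , j≤N) s<j with ℤP.<-cmp (g r) (g j)
    ... | tri< gr<gj _ _ = gr<gj
    ... | tri≈ _ gr≡gj _ = ⊥-elim (irrefl (r<s << subst (s <_) (sym (g-inj gr≡gj)) s<j))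
    ... | tri> _ _ gj<gr with proj₂ mi r j (1≤r , r<s << s<j , j≤N , gj<gr)
    ...   | inj₁ r<r = ⊥-elim (irrefl r<r)
    ...   | inj₂ (_ , j≤s) = ⊥-elim (irrefl (s<j <≤ j≤s))

    v : ℤ → ℤ
    v x = g (t n r s x)

    private
      module T = TranspositionOnWindow r s r s r∈W s∈W (Mult-x-x r) (Mult-x-x s) r≢s
      cancel-self : ∀ r s → r - r + s ≡ s
      cancel-self = solve-∀

    v-r : v r ≡ g s
    v-r = cong g (T.t-a' ∙ cancel-self r s)
    v-s : v s ≡ g r
    v-s = cong g (T.t-b' ∙ cancel-self s r)
    v-other : ∀ p → InWindow p → p ≢ r → p ≢ s → v p ≡ g p
    v-other p p∈W p≢r p≢s = cong g (T.t-other p p∈W p≢r p≢s)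

    v-per : Periodic v
    v-per x = cong g (t-periodic r s x) ∙ g-per (t n r s x)

    v-window-bounded : WindowBounded v
    v-window-bounded p p∈W with Swap.position r s r≢s p
    ... | Swap.at-x refl = subst (λ z → (r ≤ᶻ z) × (z ≤ᶻ r + N)) (sym v-r)
                             (ℤP.<⇒≤ (r<s <≤ proj₁ (g-bnd s)) , ℤP.<⇒≤ (gs<gr <≤ proj₂ (g-bnd r)))
    ... | Swap.at-y refl = subst (λ z → (s ≤ᶻ z) × (z ≤ᶻ s + N)) (sym v-s)
                             (ℤP.<⇒≤ (proj₁ (g-bnd s) ≤< gs<gr) , (proj₂ (g-bnd r) ≤≤ ℤP.+-monoˡ-≤ N (ℤP.<⇒≤ r<s)))
    ... | Swap.elsewhere p≢r p≢s = subst (λ z → (p ≤ᶻ z) × (z ≤ᶻ p + N)) (sym (v-other p p∈W p≢r p≢s)) (g-bnd p)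

    v-bnd : Bounded v
    v-bnd = bounded-from-window v-per v-window-bounded

    cover-lengths : ∀ {h : ℤ → ℤ} → InBound k n h → Covers n v h →
      Σ ℕ λ m → HasWindowLength v m × HasWindowLength h (suc m)
    cover-lengths h∈B (m , ℓv , ℓh) =
      m , WindowLength.window-length v-per v-bnd ℓv ,
      WindowLength.window-length (proj₁ (proj₁ h∈B)) (proj₁ (proj₂ h∈B)) ℓh

    agrees-beyond : ∀ {h : ℤ → ℤ} q → s ≤ᶻ q → (∀ p → InWindow p → q < p → h p ≡ v p) →
      ∀ p → q < p → p ≤ᶻ N → h p ≡ g p
    agrees-beyond q s≤q h≡v p q<p p≤N = h≡v p p∈W q<p ∙ v-other p p∈W (>⇒≢ r<p) (>⇒≢ s<p)
      where
      s<p = s≤q ≤< q<p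
      r<p = r<s << s<p
      p∈W : InWindow p
      p∈W = (1≤r ≤≤ ℤP.<⇒≤ r<p) , p≤N

    above-at-s : ∀ {h : ℤ → ℤ} → (∀ p → InWindow p → s ≤ᶻ p → h p ≡ v p) → RevLexAbove g h
    above-at-s {h} h≡v = s , s∈W , subst (g s <_) (sym (h≡v s s∈W ℤP.≤-refl ∙ v-s)) gs<gr ,
      agrees-beyond {h} s ℤP.≤-refl (λ p p∈W s<p → h≡v p p∈W (ℤP.<⇒≤ s<p))

    module MinusChild (h : ℤ → ℤ) (i : ℤ) (i<r : i < r) (i≢r : ¬ (i ≡[ n ] r))
        (h≗ : h ≗ (λ x → v (t n i r x))) (cov : Covers n v h) (h∈B : InBound k n h) where
      open ComposedWithTransposition v v-per i r r∈W (¬≡[n]⇒¬Mult i r i≢r) h h≗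
        renaming (c' to i'; c'∈W to i'∈W; c'≢r to i'≢r; h-c' to h-i'; dc to di)

      private
        h-bnd : Bounded h
        h-bnd = proj₁ (proj₂ h∈B)
        shift-2N : ∀ N → + 1 ≡ (+ 1 + (- N - N)) + (N + N)
        shift-2N = solve-∀
        drop-N : ∀ a N → a + - N + N ≡ a
        drop-N = solve-∀

      K≡-N : r < i' → K ≡ - N
      K≡-N r<i' = Mult-negsmall⇒-N di lower upper
        where
        upper : K < 0ℤ
        upper = subst (K <_) (ℤP.+-inverseʳ i') (ℤP.+-monoˡ-< (- i') (i<r << r<i'))
        -- 1 ≤ r ≤ h r = v i' + K ≤ i' + n + K ≤ 2n + K
        1≤2N+K : + 1 ≤ᶻ N + N + K
        1≤2N+K = 1≤r ≤≤ proj₁ (h-bnd r) ≤≤ ℤP.≤-reflexive h-r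
                   ≤≤ ℤP.+-monoˡ-≤ K (proj₂ (v-bnd i') ≤≤ ℤP.+-monoˡ-≤ N (proj₂ i'∈W))
        lower : - N - N < K
        lower = ℤP.suc[i]≤j⇒i<j (cancelʳ-≤ (N + N) (subst₂ _≤ᶻ_ (shift-2N N) (ℤP.+-comm (N + N) K) 1≤2N+K))

      h-i'≡ : r < i' → h i' ≡ v r + N
      h-i'≡ r<i' = h-i' ∙ cong (λ z → v r + - z) (K≡-N r<i') ∙ cong (λ z → v r + z) (ℤP.neg-involutive N)

      h-r+N≡ : r < i' → h r + N ≡ v i'
      h-r+N≡ r<i' = cong (_+ N) (h-r ∙ cong (λ z → v i' + z) (K≡-N r<i')) ∙ drop-N (v i') N

      -- For s < i' the child exceeds g at i'.  Otherwise g s + n < g i', and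
      -- then v arises from h by undoing the shifted ascent at i', r, so
      -- ℓ(v) > ℓ(h), contradicting v ⋖ h.
      above-at-i' : r < i' → s < i' → g i' < h i'
      above-at-i' r<i' s<i' with ℤP.<-cmp (g i') (g s + N)
      ... | tri< gi'<gs+N _ _ = subst (g i' <_) (sym (h-i'≡ r<i' ∙ cong (_+ N) v-r)) gi'<gs+N
      ... | tri≈ _ gi'≡gs+N _ =
        ⊥-elim (irrefl (<-pos+ {N} (proj₁ s∈W) <≤ subst (_≤ᶻ N) (g-inj (gi'≡gs+N ∙ sym (g-per s))) (proj₂ i'∈W)))
      ... | tri> _ _ gs+N<gi' = ⊥-elim (ℕP.1+n≰n (ℕP.<⇒≤ ℓv≥ℓh+1))
        where
        ℓs = cover-lengths h∈B cov
        m = proj₁ ℓs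
        vi'≡gi' : v i' ≡ g i'
        vi'≡gi' = v-other i' i'∈W (>⇒≢ r<i') (>⇒≢ s<i')
        hi'<hr+N : h i' < h r + N
        hi'<hr+N = subst₂ _<_ (sym (h-i'≡ r<i' ∙ cong (_+ N) v-r)) (sym (h-r+N≡ r<i' ∙ vi'≡gi')) gs+N<gi'
        ℓv≥ℓh+1 : 1 ℕ.+ suc m ℕ.≤ m
        ℓv≥ℓh+1 = ShiftedAscentSwap.shifted-ascent-swap h v i' r i'∈W r∈W r<i' hi'<hr+N
          (sym (h-r+N≡ r<i')) (sym (h-i'≡ r<i')) (λ p p∈W p≢i' p≢r → sym (h-other p p∈W p≢i' p≢r))
          (λ p _ → h-bnd p) v-window-bounded (proj₂ (proj₂ ℓs)) (proj₁ (proj₂ ℓs))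

      revlex-above : RevLexAbove g h
      revlex-above with ℤP.<-cmp i' r
      ... | tri< i'<r _ _ =
        above-at-s (λ p p∈W s≤p → h-other p p∈W (>⇒≢ (i'<r << r<s <≤ s≤p)) (>⇒≢ (r<s <≤ s≤p)))
      ... | tri≈ _ i'≡r _ = ⊥-elim (i'≢r i'≡r)
      ... | tri> _ _ r<i' with ℤP.<-cmp i' s
      ...   | tri< i'<s _ _ =
        above-at-s (λ p p∈W s≤p → h-other p p∈W (>⇒≢ (i'<s <≤ s≤p)) (>⇒≢ (r<s <≤ s≤p)))
      ...   | tri≈ _ i'≡s _ =
        s , s∈W , subst (g s <_) (sym (cong h (sym i'≡s) ∙ (h-i'≡ r<i' ∙ cong (_+ N) v-r))) (<-+pos 1≤N) ,
        agrees-beyond s ℤP.≤-refl (λ p p∈W s<p → h-other p p∈W (>⇒≢ (subst (_< p) (sym i'≡s) s<p)) (>⇒≢ (r<s << s<p)))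
      ...   | tri> _ _ s<i' =
        i' , i'∈W , above-at-i' r<i' s<i' ,
        agrees-beyond i' (ℤP.<⇒≤ s<i') (λ p p∈W i'<p → h-other p p∈W (>⇒≢ i'<p) (>⇒≢ (r<i' << i'<p)))

    module PlusChild (h : ℤ → ℤ) (j : ℤ) (r<j : r < j) (r≢j : ¬ (r ≡[ n ] j))
        (h≗ : h ≗ (λ x → v (t n r j x))) (cov : Covers n v h) (h∈B : InBound k n h) (h≠g : ¬ (h ≗ g)) where
      private
        j≢r : ¬ Mult (j - r)
        j≢r = ¬≡[n]⇒¬Mult r j r≢j ∘ Mult-flip {j}

      open ComposedWithTransposition v v-per j r r∈W j≢r h (λ x → h≗ x ∙ cong v (t-symmetric r j (¬≡[n]⇒¬Mult r j r≢j) x))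
        renaming (c' to j'; c'∈W to j'∈W; c'≢r to j'≢r; h-c' to h-j'; dc to dj)

      private
        h-bnd : Bounded h
        h-bnd = proj₁ (proj₂ h∈B)
        split : ∀ j j' → j ≡ j' + (j - j')
        split = solve-∀
        shift-N : ∀ N → + 1 ≡ (+ 1 + - N) + N
        shift-N = solve-∀

      K≡0 : r < j' → K ≡ 0ℤ
      K≡0 r<j' = Mult-small⇒0 dj lower upper
        where
        -- j' + K ≤ v j' + K = h r ≤ r + n < j' + n
        j'+K<j'+N : j' + K < j' + N
        j'+K<j'+N = ℤP.+-monoˡ-≤ K (proj₁ (v-bnd j')) ≤≤ ℤP.≤-reflexive (sym h-r) ≤≤ proj₂ (h-bnd r) ≤< ℤP.+-monoˡ-< N r<j'
        upper : K < N
        upper = cancelʳ-< j' (subst₂ _<_ (ℤP.+-comm j' K) (ℤP.+-comm j' N) j'+K<j'+N)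
        -- 1 ≤ r < j = j' + K ≤ n + K
        1≤N+K : + 1 ≤ᶻ N + K
        1≤N+K = 1≤r ≤≤ ℤP.<⇒≤ (subst (r <_) (split j j') r<j <≤ ℤP.+-monoˡ-≤ K (proj₂ j'∈W))
        lower : - N < K
        lower = ℤP.suc[i]≤j⇒i<j (cancelʳ-≤ N (subst₂ _≤ᶻ_ (shift-N N) (ℤP.+-comm N K) 1≤N+K))

      -- For j' = s the child would be g itself.
      not-at-s : r < j' → j' ≢ s
      not-at-s r<j' j'≡s = h≠g (λ x → h≗ x ∙ cong (λ z → g (t n r s (t n r z x))) j≡s ∙ cong g (t-involutive r s s≢r x))
        where
        j≡s : j ≡ s
        j≡s = split j j' ∙ cong (λ z → j' + z) (K≡0 r<j') ∙ ℤP.+-identityʳ j' ∙ j'≡s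
        s≢r : ¬ Mult (s - r)
        s≢r d = r≢s (sym (window-incongruent s∈W r∈W d))

      -- For s < j' the value v s = g r lies strictly between v r = g s and
      -- v j' = g j' (maximality of (r , s)), so ℓ(h) ≥ ℓ(v) + 2, contradicting v ⋖ h.
      not-beyond-s : r < j' → ¬ (s < j')
      not-beyond-s r<j' s<j' = ℕP.1+n≰n (ℕP.≤-pred ℓh≥ℓv+2)
        where
        ℓs = cover-lengths h∈B cov
        m = proj₁ ℓs
        vj'≡gj' : v j' ≡ g j'
        vj'≡gj' = v-other j' j'∈W (>⇒≢ r<j') (>⇒≢ s<j')
        drop-K : ∀ a → a + - K ≡ a
        drop-K a = cong (λ z → a + - z) (K≡0 r<j') ∙ ℤP.+-identityʳ a
        ℓh≥ℓv+2 : 2 ℕ.+ m ℕ.≤ suc m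
        ℓh≥ℓv+2 = IntermediateValueSwap.intermediate-value-swap v h r j' s r∈W j'∈W s∈W r<s s<j'
          (subst₂ _<_ (sym v-r) (sym v-s) gs<gr)
          (subst₂ _<_ (sym v-s) (sym vj'≡gj') (beyond-s-ascent j' j'∈W s<j'))
          (h-r ∙ cong (λ z → v j' + z) (K≡0 r<j') ∙ ℤP.+-identityʳ (v j')) (h-j' ∙ drop-K (v r))
          (λ p p∈W p≢r p≢j' → h-other p p∈W p≢j' p≢r)
          v-window-bounded (λ p _ → h-bnd p) (proj₁ (proj₂ ℓs)) (proj₂ (proj₂ ℓs))

      revlex-above : RevLexAbove g h
      revlex-above with ℤP.<-cmp j' r
      ... | tri< j'<r _ _ =
        above-at-s (λ p p∈W s≤p → h-other p p∈W (>⇒≢ (j'<r << r<s <≤ s≤p)) (>⇒≢ (r<s <≤ s≤p)))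
      ... | tri≈ _ j'≡r _ = ⊥-elim (j'≢r j'≡r)
      ... | tri> _ _ r<j' with ℤP.<-cmp j' s
      ...   | tri< j'<s _ _ =
        above-at-s (λ p p∈W s≤p → h-other p p∈W (>⇒≢ (j'<s <≤ s≤p)) (>⇒≢ (r<s <≤ s≤p)))
      ...   | tri≈ _ j'≡s _ = ⊥-elim (not-at-s r<j' j'≡s)
      ...   | tri> _ _ s<j' = ⊥-elim (not-beyond-s r<j' s<j')

  child-above : ∀ k g h → InBound k n g → Child k n g h → RevLexAbove g h × InBound k n h
  child-above k g h g∈B (r , s , mi , inj₁ ((i , i<r , i≢r , h≗ , cov) , h∈B)) =
    AtMaximalInversion.MinusChild.revlex-above k g g∈B r s mi h i i<r i≢r h≗ cov h∈B , h∈B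
  child-above k g h g∈B (r , s , mi , inj₂ (((j , r<j , r≢j , h≗ , cov) , h∈B) , h≠g)) =
    AtMaximalInversion.PlusChild.revlex-above k g g∈B r s mi h j r<j r≢j h≗ cov h∈B h≠g , h∈B

  -- The weight: window displacements as base-(n+1) digits

  digit : (ℤ → ℤ) → ℕ → ℕ
  digit F p = ℤ.∣ F (+ p) - + p ∣

  weight : (ℤ → ℤ) → ℕ → ℕ
  weight F zero = 0
  weight F (suc p) = weight F p ℕ.+ digit F (suc p) ℕ.* (suc n ℕ.^ p)

  private
    suc∈W : ∀ {p} → suc p ℕ.≤ n → InWindow (+ suc p)
    suc∈W p<n = +≤+ (ℕ.s≤s ℕ.z≤n) , +≤+ p<n

    0≤diff : ∀ {F p} → WindowBounded F → InWindow p → 0ℤ ≤ᶻ F p - p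
    0≤diff {p = p} wb p∈W = ℤP.i≤j⇒0≤j-i (proj₁ (wb p p∈W))

  digit≤n : ∀ {F} → WindowBounded F → ∀ p → suc p ℕ.≤ n → digit F (suc p) ℕ.≤ n
  digit≤n {F} wb p p<n = abs≤ (0≤diff wb (suc∈W p<n)) diff≤N
    where
    p+N-p : ∀ p N → p + N - p ≡ N
    p+N-p = solve-∀
    diff≤N : F (+ suc p) - + suc p ≤ᶻ N
    diff≤N = subst (_ ≤ᶻ_) (p+N-p (+ suc p) N) (ℤP.+-monoˡ-≤ (- + suc p) (proj₂ (wb _ (suc∈W p<n))))
    abs≤ : ∀ {z} → 0ℤ ≤ᶻ z → z ≤ᶻ N → ℤ.∣ z ∣ ℕ.≤ n
    abs≤ {+ _} _ (+≤+ m≤n) = m≤n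

  weight< : ∀ {F} → WindowBounded F → ∀ m → m ℕ.≤ n → weight F m ℕ.< suc n ℕ.^ m
  weight< wb zero _ = ℕ.s≤s ℕ.z≤n
  weight< wb (suc m) m<n =
    ℕP.+-mono-<-≤ (weight< wb m (ℕP.<⇒≤ m<n)) (ℕP.*-monoˡ-≤ (suc n ℕ.^ m) (digit≤n wb m m<n))

  weight-increases : ∀ {G H} → WindowBounded G → WindowBounded H → ∀ q → suc q ℕ.≤ n →
    digit G (suc q) ℕ.< digit H (suc q) →
    (∀ p → suc q ℕ.< p → p ℕ.≤ n → digit H p ≡ digit G p) →
    ∀ m → suc q ℕ.≤ m → m ℕ.≤ n → weight G m ℕ.< weight H m
  weight-increases {G} {H} wbG wbH q q<n digit< same (suc m) q<m m<n with suc q ℕ.≟ suc m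
  ... | yes q≡m rewrite ℕP.suc-injective q≡m =
    ℕP.<-≤-trans (ℕP.+-monoˡ-< (digit G (suc m) ℕ.* (suc n ℕ.^ m)) (weight< wbG m (ℕP.<⇒≤ m<n)))
      (ℕP.≤-trans (ℕP.*-monoˡ-≤ (suc n ℕ.^ m) digit<) (ℕP.m≤n+m (digit H (suc m) ℕ.* (suc n ℕ.^ m)) (weight H m)))
  ... | no q≢m =
    subst (λ d → weight G m ℕ.+ digit G (suc m) ℕ.* (suc n ℕ.^ m) ℕ.< weight H m ℕ.+ d ℕ.* (suc n ℕ.^ m))
      (sym (same (suc m) (ℕP.≤∧≢⇒< q<m q≢m) m<n))
      (ℕP.+-monoˡ-< (digit G (suc m) ℕ.* (suc n ℕ.^ m))
        (weight-increases wbG wbH q q<n digit< same m (ℕP.≤-pred (ℕP.≤∧≢⇒< q<m q≢m)) (ℕP.<⇒≤ m<n)))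

  revlex⇒weight< : ∀ {G H} → WindowBounded G → WindowBounded H → RevLexAbove G H → weight G n ℕ.< weight H n
  revlex⇒weight< _ _ (+ zero , (+≤+ () , _) , _)
  revlex⇒weight< {G} {H} wbG wbH (+ suc q , (_ , +≤+ q<n) , Gq<Hq , same) =
    weight-increases wbG wbH q q<n digit< same-digit n q<n ℕP.≤-refl
    where
    abs< : ∀ {a b} → 0ℤ ≤ᶻ a → a < b → ℤ.∣ a ∣ ℕ.< ℤ.∣ b ∣
    abs< {+ _} {+ _} _ (+<+ a<b) = a<b
    digit< : digit G (suc q) ℕ.< digit H (suc q)
    digit< = abs< (0≤diff wbG (suc∈W q<n)) (ℤP.+-monoˡ-< (- + suc q) Gq<Hq)
    same-digit : ∀ p → suc q ℕ.< p → p ℕ.≤ n → digit H p ≡ digit G p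
    same-digit p q<p p≤n = cong (λ z → ℤ.∣ z - + p ∣) (same (+ p) (+<+ q<p) (+≤+ p≤n))

  -- Paths are short and their windows are bounded

  window-bounded : ∀ {k F} → InBound k n F → WindowBounded F
  window-bounded F∈B p _ = proj₁ (proj₂ F∈B) p

  -- the weight grows along every path and stays below (n+1)^n
  path-length : ∀ {k g ps} → InBound k n g → Path k n g ps → length ps ℕ.+ weight g n ℕ.< suc n ℕ.^ n
  path-length g∈B stop = weight< (window-bounded g∈B) n ℕP.≤-refl
  path-length {k} {g} g∈B (step {h = h} {ps = ps} child path) =
    ℕP.≤-<-trans (ℕP.+-monoʳ-< (length ps) (revlex⇒weight< (window-bounded g∈B) (window-bounded h∈B) above))
      (path-length h∈B path)
    where
    above = proj₁ (child-above k g h g∈B child)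
    h∈B = proj₂ (child-above k g h g∈B child)

  path-bounded : ∀ {k g ps} → InBound k n g → Path k n g ps → All (InBound k n) ps
  path-bounded g∈B stop = []
  path-bounded {k} {g} g∈B (step {h = h} child path) = h∈B ∷ path-bounded h∈B path
    where
    h∈B = proj₂ (child-above k g h g∈B child)

  -- Finiteness

  values : ℕ → List ℤ
  values zero = []
  values (suc m) = + suc m ∷ values m

  values-complete : ∀ m z → + 1 ≤ᶻ z → z ≤ᶻ + m → z ∈ values m
  values-complete m (+ zero) (+≤+ ()) _
  values-complete m (+ suc z) _ (+≤+ z<m) = go m z<m
    where
    go : ∀ m → suc z ℕ.≤ m → + suc z ∈ values m
    go (suc m) (ℕ.s≤s z≤m) with z ℕ.≟ m
    ... | yes refl = here refl
    ... | no z≢m = there (go m (ℕP.≤∧≢⇒< z≤m z≢m))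

  window-values : ∀ {k g} → InBound k n g → window n g ∈ vectorsOver (values (n ℕ.+ n)) n
  window-values {k} {g} g∈B = vectorsOver-complete n _ λ i →
    values-complete (n ℕ.+ n) _ (+≤+ (ℕ.s≤s ℕ.z≤n) ≤≤ proj₁ (bnd i)) (proj₂ (bnd i) ≤≤ ℤP.+-monoˡ-≤ N (+≤+ (FP.toℕ<n i)))
    where
    bnd : ∀ (i : Fin n) → (+ suc (toℕ i) ≤ᶻ g (+ suc (toℕ i))) × (g (+ suc (toℕ i)) ≤ᶻ + suc (toℕ i) + N)
    bnd i = proj₁ (proj₂ g∈B) (+ suc (toℕ i))

  tree-finite : ∀ k f → InBound k n f → TreeFinite k n f
  tree-finite k f f∈B = listsOver (vectorsOver (values (n ℕ.+ n)) n) (suc n ℕ.^ n) , λ ps path →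
    listsOver-complete _ (map (window n) ps)
      (Allₚ.map⁺ (All.map window-values (path-bounded f∈B path)))
      (subst (ℕ._≤ suc n ℕ.^ n) (sym (LP.length-map (window n) ps))
        (ℕP.<⇒≤ (ℕP.≤-<-trans (ℕP.m≤m+n (length ps) (weight f n)) (path-length f∈B path))))

theorem3p7 : (k n : ℕ) → .{{_ : NonZero n}} → k ≤ n →
    (f : ℤ → ℤ) → InBound k n f → TreeFinite k n f
theorem3p7 k n _ f f∈B = Period.tree-finite n k f f∈B
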